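{- Let $C$ be a signed Euler system of a 4-regular graph $F$ which includes a circuit $v^{+}T_1w^{+}T_2v^{ - }T_3w^{ - }T_4$ (where $T_1,\dots,T_4$ are trails). Let $C\ast(vw)$ be the signed Euler system obtained from $C$ by replacing this circuit with $v^{+}T_3w^{ - }T_2v^{ - }T_1w^{+}T_4$ (all other circuits, and the signs of all passages in $T_1,\dots,T_4$, unchanged). Let $P$ be a circuit partition of $F$ with $P(x)\neq\psi_C(x)$ for all $x\in V(F)$. Writing $\rho_x(M)$ for the $x$ row of a matrix $M$: (1) $\rho_v(M_{\mathbb{R}}^0(C\ast(vw),P))=\rho_w(M_{\mathbb{R}}^0(C,P))$; (2) $\rho_w(M_{\mathbb{R}}^0(C\ast(vw),P))=-\rho_v(M_{\mathbb{R}}^0(C,P))$; (3) for $x\in V(F)\setminus\{v,w\}$, $\rho_x(M_{\mathbb{R}}^0(C\ast(vw),P))=\rho_x(M_{\mathbb{R}}^0(C,P))+\mathcal{I}_{\mathbb{R}}(C)_{xw}\,\rho_v(M_{\mathbb{R}}^0(C,P))-\mathcal{I}_{\mathbb{R}}(C)_{xv}\,\rho_w(M_{\mathbb{R}}^0(C,P))$.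
   Context: Graphs are finite multigraphs (loops, parallel edges allowed); each edge has two half-edges; $F$ is 4-regular if each vertex is incident on four half-edges. A circuit is a closed walk (with a direction, up to cyclic shift) using no edge twice; an Euler system of $F$ is a set of circuits, one per connected component, using each edge exactly once. A circuit partition of $F$ is a partition of $E(F)$ into edge-disjoint circuits; at each vertex $v$ it determines the transition $P(v)$: the partition of the four half-edges at $v$ into the two pairs with which its circuits pass through $v$. A signed Euler system is an Euler system $C$ together with, for each vertex $v$, a designation of one of the two passages of $C$ through $v$ as $v^{+}$ and the other as $v^{ - }$; circuits are written as cyclic words in these symbols. Write the passage $v^{+}$ as $h^1_v,v,h^2_v$ and $v^{ - }$ as $h^3_v,v,h^4_v$ (entering, leaving half-edges). Transitions: $\phi_C(v)=\{\{h^1_v,h^2_v\},\{h^3_v,h^4_v\}\}$, $\chi_C(v)=\{\{h^1_v,h^4_v\},\{h^2_v,h^3_v\}\}$, $\psi_C(v)=\{\{h^1_v,h^3_v\},\{h^2_v,h^4_v\}\}$. $\mathcal{I}_{\mathbb{R}}(C)$ is the $V(F)\times V(F)$ matrix with zero diagonal whose $vw$ entry ($v\neq w$) is $1$ if $v,w$ appear on a circuit of $C$ in the cyclic order $v^{+}w^{ - }v^{ - }w^{+}$, $-1$ if in the cyclic order $v^{+}w^{+}v^{ - }w^{ - }$, and $0$ otherwise (i.e. if not interlaced). For a circuit partition $P$ with $P(x)\neq\psi_C(x)$ for all $x$, $M_{\mathbb{R}}^0(C,P)$ is the $V(F)\times V(F)$ integer matrix whose $w$ column is the standard unit vector at $w$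 if $P(w)=\phi_C(w)$, and is the $w$ column of $\mathcal{I}_{\mathbb{R}}(C)$ if $P(w)=\chi_C(w)$. The transition labels with respect to $C\ast(vw)$ are computed from its own signed circuit in the same way. -}

module Defs where

open import Data.Nat using (ℕ)
open import Data.Fin using (Fin) renaming (_≟_ to _≟ᶠ_)
open import Data.Bool using (Bool; true; false; not)
open import Data.Product using (Σ; ∃; ∃-syntax; _×_; _,_; proj₁; proj₂)
open import Data.Sum using (_⊎_)
open import Data.List using (List; []; _∷_; _++_; [_]; concatMap; map; zipWith; length; filter; allFin)
open import Data.List.Membership.Propositional using (_∈_)
open import Data.List.Relation.Unary.All using (All)
open import Data.List.Relation.Unary.AllPairs using (AllPairs)
open import Data.List.Relation.Binary.Permutation.Propositional using (_↭_)
open import Data.Integer using (ℤ; +_; -[1+_])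
open import Relation.Binary.PropositionalEquality using (_≡_; _≢_)
open import Relation.Nullary using (¬_; does)

-- Edges are Fin nE; edge e has two half-edges he e false, he e true;
-- ends e b is the vertex incident to half-edge he e b.  Loops and
-- parallel edges are allowed.

record Graph : Set where
  field
    nV   : ℕ
    nE   : ℕ
    ends : Fin nE → Bool → Fin nV
open Graph public

record HalfEdge (G : Graph) : Set where
  constructor he
  field
    hedge : Fin (nE G)
    hend  : Bool
open HalfEdge public

vtx : (G : Graph) → HalfEdge G → Fin (nV G)
vtx G (he e b) = ends G e b

allHalfEdges : (G : Graph) → List (HalfEdge G)
allHalfEdges G = concatMap (λ e → he e false ∷ he e true ∷ []) (allFin (nE G))

FourRegular : Graph → Set
FourRegular G = ∀ (v : Fin (nV G)) →
  length (filter (λ h → vtx G h ≟ᶠ v) (allHalfEdges G)) ≡ 4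

-- Darts (directed traversals of an edge) and circuits.
-- dart e b: traverse e leaving through half-edge he e b and
-- entering through half-edge he e (not b).

record Dart (G : Graph) : Set where
  constructor dart
  field
    dedge  : Fin (nE G)
    dstart : Bool
open Dart public

tailHE : {G : Graph} → Dart G → HalfEdge G
tailHE (dart e b) = he e b

headHE : {G : Graph} → Dart G → HalfEdge G
headHE (dart e b) = he e (not b)

-- A passage through a vertex: (entering half-edge , leaving half-edge).
Passage : Graph → Set
Passage G = HalfEdge G × HalfEdge G

passages : {G : Graph} → List (Dart G) → List (Passage G)
passages [] = []
passages (d ∷ ds) = zipWith (λ a b → (headHE a , tailHE b)) (d ∷ ds) (ds ++ [ d ])

-- A circuit: a nonempty cyclic list of darts, consecutive darts meeting
-- at a common vertex.  (No edge repeated is imposed globally below.)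
IsCircuit : (G : Graph) → List (Dart G) → Set
IsCircuit G ds = (ds ≢ []) × All (λ p → vtx G (proj₁ p) ≡ vtx G (proj₂ p)) (passages ds)

edgesOf : {G : Graph} → List (List (Dart G)) → List (Fin (nE G))
edgesOf cs = concatMap (map dedge) cs

IsCircuitPartition : (G : Graph) → List (List (Dart G)) → Set
IsCircuitPartition G cs = All (IsCircuit G) cs × (edgesOf cs ↭ allFin (nE G))

verticesOf : {G : Graph} → List (Dart G) → List (Fin (nV G))
verticesOf {G} ds = map (λ d → vtx G (tailHE d)) ds

-- An Euler system: a circuit partition with one circuit per connected
-- component, i.e. (since circuits are connected and cover all edges)
-- pairwise vertex-disjoint circuits.
IsEulerSystem : (G : Graph) → List (List (Dart G)) → Set
IsEulerSystem G cs = IsCircuitPartition G cs ×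
  AllPairs (λ c c' → ∀ x → x ∈ verticesOf {G} c → ¬ (x ∈ verticesOf {G} c')) cs

allPassages : {G : Graph} → List (List (Dart G)) → List (Passage G)
allPassages cs = concatMap passages cs

-- Signed Euler systems.  The passage v⁺ is designated by its entering
-- half-edge  plus v  (each half-edge is entered by at most one passage).

record SignedSys (G : Graph) : Set where
  constructor ⟨_,_⟩
  field
    circuits : List (List (Dart G))
    plus     : Fin (nV G) → HalfEdge G
open SignedSys public

IsSignedEuler : (G : Graph) → SignedSys G → Set
IsSignedEuler G C = IsEulerSystem G (circuits C) ×
  (∀ v → (vtx G (plus C v) ≡ v) × ∃[ h ] ((plus C v , h) ∈ allPassages (circuits C)))

IsPlus : {G : Graph} → SignedSys G → Fin (nV G) → Passage G → Set
IsPlus C v p = (p ∈ allPassages (circuits C)) × (proj₁ p ≡ plus C v)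

IsMinus : {G : Graph} → SignedSys G → Fin (nV G) → Passage G → Set
IsMinus {G} C v p = (p ∈ allPassages (circuits C)) × (vtx G (proj₁ p) ≡ v) × (proj₁ p ≢ plus C v)

-- Transitions of a circuit partition P: {a , b} is a pair of P(x) iff
-- some circuit of P passes through x entering at a and leaving at b
-- or vice versa.

PairIn : {G : Graph} → List (List (Dart G)) → HalfEdge G → HalfEdge G → Set
PairIn P a b = ((a , b) ∈ allPassages P) ⊎ ((b , a) ∈ allPassages P)

-- With v⁺ = h1 v h2 and v⁻ = h3 v h4:
-- P(x) = φ_C(x) = {{h1,h2},{h3,h4}}
IsPhi : {G : Graph} → SignedSys G → List (List (Dart G)) → Fin (nV G) → Set
IsPhi C P x = ∃[ h1 ] ∃[ h2 ] ∃[ h3 ] ∃[ h4 ]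
  (IsPlus C x (h1 , h2) × IsMinus C x (h3 , h4) × PairIn P h1 h2 × PairIn P h3 h4)

IsChi : {G : Graph} → SignedSys G → List (List (Dart G)) → Fin (nV G) → Set
IsChi C P x = ∃[ h1 ] ∃[ h2 ] ∃[ h3 ] ∃[ h4 ]
  (IsPlus C x (h1 , h2) × IsMinus C x (h3 , h4) × PairIn P h1 h4 × PairIn P h2 h3)

IsPsi : {G : Graph} → SignedSys G → List (List (Dart G)) → Fin (nV G) → Set
IsPsi C P x = ∃[ h1 ] ∃[ h2 ] ∃[ h3 ] ∃[ h4 ]
  (IsPlus C x (h1 , h2) × IsMinus C x (h3 , h4) × PairIn P h1 h3 × PairIn P h2 h4)

CyclicOrder : {A : Set} → List A → A → A → A → A → Set
CyclicOrder {A} xs a b c d = Σ (List A × List A) λ r →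
  (proj₁ r ++ proj₂ r ≡ xs) ×
  ∃[ l1 ] ∃[ l2 ] ∃[ l3 ] ∃[ l4 ] ∃[ l5 ]
    (proj₂ r ++ proj₁ r ≡ l1 ++ a ∷ l2 ++ b ∷ l3 ++ c ∷ l4 ++ d ∷ l5)

OrderPos : {G : Graph} → SignedSys G → Fin (nV G) → Fin (nV G) → Set
OrderPos {G} C v w = Σ (List (Dart G)) λ c → (c ∈ circuits C) ×
  ∃[ p1 ] ∃[ p2 ] ∃[ p3 ] ∃[ p4 ]
    (IsPlus C v p1 × IsMinus C w p2 × IsMinus C v p3 × IsPlus C w p4 ×
     CyclicOrder (passages c) p1 p2 p3 p4)

OrderNeg : {G : Graph} → SignedSys G → Fin (nV G) → Fin (nV G) → Set
OrderNeg {G} C v w = Σ (List (Dart G)) λ c → (c ∈ circuits C) ×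
  ∃[ p1 ] ∃[ p2 ] ∃[ p3 ] ∃[ p4 ]
    (IsPlus C v p1 × IsPlus C w p2 × IsMinus C v p3 × IsMinus C w p4 ×
     CyclicOrder (passages c) p1 p2 p3 p4)

Matrix : ℕ → Set
Matrix n = Fin n → Fin n → ℤ

IsInterlacement : {G : Graph} → SignedSys G → Matrix (nV G) → Set
IsInterlacement C I = ∀ v w →
  ((v ≡ w) → I v w ≡ + 0) ×
  ((v ≢ w) →
     (OrderPos C v w → I v w ≡ + 1) ×
     (OrderNeg C v w → I v w ≡ -[1+ 0 ]) ×
     (¬ OrderPos C v w → ¬ OrderNeg C v w → I v w ≡ + 0))

δ : {n : ℕ} → Fin n → Fin n → ℤ
δ x w with does (x ≟ᶠ w)
... | true  = + 1
... | false = + 0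

IsM0 : {G : Graph} → SignedSys G → List (List (Dart G)) → Matrix (nV G) → Matrix (nV G) → Set
IsM0 C P I M = ∀ x w →
  (IsPhi C P w → M x w ≡ δ x w) × (IsChi C P w → M x w ≡ I x w)

-- C ∗ (vw): the circuit v⁺T1w⁺T2v⁻T3w⁻T4 (darts T1 ++ T2 ++ T3 ++ T4,
-- up to rotation), sitting between circuit lists A and B, is replaced by
-- v⁺T3w⁻T2v⁻T1w⁺T4 (darts T3 ++ T2 ++ T1 ++ T4).  Each new passage at v
-- or w has the same entering half-edge as the old passage with the same
-- sign, and all other passages are unchanged, so  plus  is unchanged.

starVW : {G : Graph} → SignedSys G → (A B : List (List (Dart G))) →
         (T1 T2 T3 T4 : List (Dart G)) → SignedSys G
starVW C A B T1 T2 T3 T4 = ⟨ A ++ (T3 ++ T2 ++ T1 ++ T4) ∷ B , plus C ⟩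

module Submission where

-- The three row identities follow column by column (RowIdentities) from two local facts about
-- the transposition, both proved in the module Setting:
--  * transitions (Transitions): every transition of P is φ or χ; those at v and w are
--    exchanged, all others are kept;
--  * interlacement (Interlacement): the entries of I_R change by explicit rules
--    (InterlacementChange), e.g.  I′ x v = I x w  and
--    I′ x y = I x y + I x w · I v y − I x v · I w y  for x, y ∉ {v, w}.
-- For the second, the passages at v, w and at most two further vertices x, y are labelled by
-- letters (Labelling); an interlacement entry is then the interlacement value of two letter
-- pairs in the cyclic word of a circuit (LabelledInterlacement).  Before and after the
-- transposition the words are  m₁W⁺m₂V⁻m₃W⁻m₄V⁺  and  m₃W⁻m₂V⁻m₁W⁺m₄V⁺, m_i being the letters
-- inside the trail T_i, and the rules are verified by evaluation over all ways of placing the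
-- letters of x and y (oneVertexRule, twoVertexRule); vertices off the circuit contribute zeros.

open import Defs
open import Data.Nat using (ℕ; zero; suc; _≤_; z≤n; s≤s) renaming (_≟_ to _≟ℕ_)
open import Data.Nat.Properties using (≤-antisym)
open import Data.Fin using (Fin) renaming (_≟_ to _≟ᶠ_)
open import Data.Bool using (Bool; true; false; not; T; _∧_; _∨_)
open import Data.Bool.Properties using () renaming (_≟_ to _≟ᵇ_)
open import Data.Maybe using (Maybe; just; nothing; maybe′)
open import Data.Maybe.Properties using (just-injective)
open import Data.Product using (Σ; ∃; ∃-syntax; ∃₂; _×_; _,_; proj₁; proj₂)
open import Data.Product.Properties using (≡-dec)
open import Data.Sum using (_⊎_; inj₁; inj₂)
open import Data.Empty using (⊥; ⊥-elim)
open import Data.Unit using (⊤; tt)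
open import Data.List using (List; []; _∷_; _++_; [_]; _∷ʳ_; length; filter; concatMap; concat; map; zipWith; allFin; mapMaybe)
open import Data.List.Properties using (++-assoc; ++-identityʳ; ∷-injective; concatMap-++; concatMap-map; map-++; mapMaybe-++)
open import Data.List.Membership.Propositional using (_∈_; find; lose)
open import Data.List.Membership.Propositional.Properties using (∈-++⁻; ∈-++⁺ˡ; ∈-++⁺ʳ; ∈-∃++; ∈-filter⁺; ∈-filter⁻; ∈-allFin; ∈-concatMap⁺; ∈-concatMap⁻; ∈-map⁺; ∈-map⁻)
open import Data.List.Relation.Unary.Any using (here; there; any?)
open import Data.List.Relation.Unary.All using (All; []; _∷_; tabulate) renaming (lookup to All-lookup)
open import Data.List.Relation.Unary.AllPairs using (AllPairs; []; _∷_)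
open import Data.List.Relation.Unary.Unique.Propositional using (Unique)
open import Data.List.Relation.Unary.Unique.Propositional.Properties using (filter⁺; allFin⁺)
open import Data.List.Relation.Binary.Permutation.Propositional using (_↭_; prep; ↭-sym; ↭-refl; ↭-trans; ↭-reflexive; ↭⇒↭ₛ)
open import Data.List.Relation.Binary.Permutation.Propositional.Properties using (∈-resp-↭; ++-comm; shift; ++⁺; ++⁺ˡ; ++⁺ʳ) renaming (map⁺ to ↭-map⁺)
import Data.List.Relation.Binary.Permutation.Setoid.Properties as SetoidPermutation
open import Data.List.Relation.Binary.Sublist.Propositional using ([]; _∷_) renaming (_⊆_ to _⊑_; _∷ʳ_ to skip)
open import Data.Integer using (ℤ; +_; -[1+_]; _+_; _-_; _*_; -_)
open import Data.Integer.Properties using (*-zeroˡ) renaming (_≟_ to _≟ℤ_)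
open import Data.Integer.Tactic.RingSolver using (solve-∀)
open import Relation.Binary.PropositionalEquality using (_≡_; _≢_; refl; sym; trans; cong; cong₂; subst; setoid; module ≡-Reasoning)
open import Relation.Binary.Definitions using (DecidableEquality)
open import Relation.Nullary using (¬_; Dec; yes; no; does; isYes; ¬?; _×-dec_)
open import Relation.Nullary.Decidable using (toWitness; fromWitness; map′; dec-true; dec-false)
import Data.List.Membership.DecPropositional

module _ {A : Set} where

  unique-↭ : {xs ys : List A} → xs ↭ ys → Unique xs → Unique ys
  unique-↭ p = SetoidPermutation.Unique-resp-↭ (setoid A) (↭⇒↭ₛ p)

  private
    length-middle : (F₁ F₂ : List A) (x : A) → length (F₁ ++ x ∷ F₂) ≡ suc (length (F₁ ++ F₂))
    length-middle []       F₂ x = refl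
    length-middle (y ∷ F₁) F₂ x = cong suc (length-middle F₁ F₂ x)

    remove : {z x : A} (F₁ F₂ : List A) → z ∈ F₁ ++ x ∷ F₂ → z ≢ x → z ∈ F₁ ++ F₂
    remove []       F₂ (here z≡x) z≢x = ⊥-elim (z≢x z≡x)
    remove []       F₂ (there m)  _   = m
    remove (y ∷ F₁) F₂ (here z≡y) _   = here z≡y
    remove (y ∷ F₁) F₂ (there m)  z≢x = there (remove F₁ F₂ m z≢x)

  unique-length-≤ : {u : List A} (F : List A) → Unique u → (∀ {z} → z ∈ u → z ∈ F) → length u ≤ length F
  unique-length-≤ {[]} F _ _ = z≤n
  unique-length-≤ {x ∷ u} F (x∉u ∷ u-unique) u⊆F with ∈-∃++ (u⊆F (here refl))
  ... | F₁ , F₂ , refl rewrite length-middle F₁ F₂ x =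
    s≤s (unique-length-≤ (F₁ ++ F₂) u-unique
          (λ z∈u → remove F₁ F₂ (u⊆F (there z∈u)) (λ { refl → All-lookup x∉u z∈u refl })))

  unique-++⁻ʳ : (xs : List A) {ys : List A} → Unique (xs ++ ys) → Unique ys
  unique-++⁻ʳ []       u       = u
  unique-++⁻ʳ (x ∷ xs) (_ ∷ u) = unique-++⁻ʳ xs u

  unique-++⁻ˡ : (xs : List A) {ys : List A} → Unique (xs ++ ys) → Unique xs
  unique-++⁻ˡ []       u        = []
  unique-++⁻ˡ (x ∷ xs) (x∉ ∷ u) = tabulate (λ m → All-lookup x∉ (∈-++⁺ˡ m)) ∷ unique-++⁻ˡ xs u

  unique-++-disjoint : (xs : List A) {ys : List A} {e : A} → Unique (xs ++ ys) → e ∈ xs → e ∈ ys → ⊥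
  unique-++-disjoint (x ∷ xs) (x∉ ∷ u) (here refl) e∈ys = All-lookup x∉ (∈-++⁺ʳ xs e∈ys) refl
  unique-++-disjoint (x ∷ xs) (_ ∷ u)  (there e∈xs) e∈ys = unique-++-disjoint xs u e∈xs e∈ys

module _ {A B : Set} (f : B → List A) where

  ∈-concatMap-intro : {cs : List B} {c : B} {e : A} → c ∈ cs → e ∈ f c → e ∈ concatMap f cs
  ∈-concatMap-intro c∈ e∈ = ∈-concatMap⁺ f (lose c∈ e∈)

  ∈-concatMap-elim : {cs : List B} {e : A} → e ∈ concatMap f cs → ∃ λ c → (c ∈ cs) × (e ∈ f c)
  ∈-concatMap-elim {cs} m = find (∈-concatMap⁻ f {xs = cs} m)

  unique-concatMap-block : (cs : List B) {c₁ c₂ : B} {e : A} → Unique (concatMap f cs) →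
    c₁ ∈ cs → c₂ ∈ cs → e ∈ f c₁ → e ∈ f c₂ → c₁ ≡ c₂
  unique-concatMap-block (c ∷ cs) u (here refl) (here refl) _ _ = refl
  unique-concatMap-block (c ∷ cs) u (here refl) (there i₂) m₁ m₂ =
    ⊥-elim (unique-++-disjoint (f c) u m₁ (∈-concatMap-intro i₂ m₂))
  unique-concatMap-block (c ∷ cs) u (there i₁) (here refl) m₁ m₂ =
    ⊥-elim (unique-++-disjoint (f c) u m₂ (∈-concatMap-intro i₁ m₁))
  unique-concatMap-block (c ∷ cs) u (there i₁) (there i₂) m₁ m₂ =
    unique-concatMap-block cs (unique-++⁻ʳ (f c) u) i₁ i₂ m₁ m₂

  disjoint-blocks-same : (cs : List B) → AllPairs (λ c c' → ∀ x → x ∈ f c → ¬ (x ∈ f c')) cs →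
    {c₁ c₂ : B} {x : A} → c₁ ∈ cs → c₂ ∈ cs → x ∈ f c₁ → x ∈ f c₂ → c₁ ≡ c₂
  disjoint-blocks-same (c ∷ cs) (_ ∷ _)  (here refl) (here refl) _ _ = refl
  disjoint-blocks-same (c ∷ cs) (d ∷ _)  (here refl) (there i₂) m₁ m₂ = ⊥-elim (All-lookup d i₂ _ m₁ m₂)
  disjoint-blocks-same (c ∷ cs) (d ∷ _)  (there i₁) (here refl) m₁ m₂ = ⊥-elim (All-lookup d i₁ _ m₂ m₁)
  disjoint-blocks-same (c ∷ cs) (_ ∷ ds) (there i₁) (there i₂) m₁ m₂ = disjoint-blocks-same cs ds i₁ i₂ m₁ m₂

-- Moving four distinguished entries of  Q₁ ++ p ∷ Q₂ ++ q ∷ Q₃ ++ r ∷ Q₄ ++ s ∷ []  to the front.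
-- This is how the passages of the circuit  T₁T₂T₃T₄  split into the four passages between
-- consecutive trails and the passages inside the trails.
module _ {A : Set} where

  interior : List A → List A → List A → List A → List A
  interior Q₁ Q₂ Q₃ Q₄ = Q₁ ++ Q₂ ++ Q₃ ++ Q₄

  blocks : List A → List A → List A → List A → A → A → A → A → List A
  blocks Q₁ Q₂ Q₃ Q₄ p q r s = Q₁ ++ p ∷ Q₂ ++ q ∷ Q₃ ++ r ∷ Q₄ ++ s ∷ []

  blocks-↭ : (Q₁ Q₂ Q₃ Q₄ : List A) (p q r s : A) →
    blocks Q₁ Q₂ Q₃ Q₄ p q r s ↭ p ∷ q ∷ r ∷ s ∷ interior Q₁ Q₂ Q₃ Q₄
  blocks-↭ Q₁ Q₂ Q₃ Q₄ p q r s =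
    ↭-trans (shift p Q₁ _) (prep p (
    ↭-trans (front q Q₁ Q₂ _) (prep q (
    ↭-trans (front r (Q₁ ++ Q₂) Q₃ _) (prep r (
    ↭-trans (front s ((Q₁ ++ Q₂) ++ Q₃) Q₄ []) (prep s (↭-reflexive tidy))))))))
    where
    front : (x : A) (X Y Z : List A) → X ++ Y ++ x ∷ Z ↭ x ∷ (X ++ Y) ++ Z
    front x X Y Z = ↭-trans (↭-reflexive (sym (++-assoc X Y (x ∷ Z)))) (shift x (X ++ Y) Z)
    tidy : (((Q₁ ++ Q₂) ++ Q₃) ++ Q₄) ++ [] ≡ interior Q₁ Q₂ Q₃ Q₄
    tidy = trans (++-identityʳ _) (trans (++-assoc (Q₁ ++ Q₂) Q₃ Q₄) (++-assoc Q₁ Q₂ (Q₃ ++ Q₄)))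

  swap-blocks-↭ : (a b c d : List A) → a ++ b ++ c ++ d ↭ c ++ b ++ a ++ d
  swap-blocks-↭ a b c d =
    ↭-trans (↭-reflexive (sym (trans (++-assoc a (b ++ c) d) (cong (a ++_) (++-assoc b c d)))))
    (↭-trans (++⁺ʳ d (↭-trans (++-comm a (b ++ c)) (↭-trans (++⁺ʳ a (++-comm b c)) (↭-reflexive (++-assoc c b a)))))
    (↭-reflexive (trans (++-assoc c (b ++ a) d) (cong (c ++_) (++-assoc b a d)))))

  data Among4 (p q r s : A) (Q : List A) (e : A) : Set where
    is-p : e ≡ p → Among4 p q r s Q e
    is-q : e ≡ q → Among4 p q r s Q e
    is-r : e ≡ r → Among4 p q r s Q e
    is-s : e ≡ s → Among4 p q r s Q e
    in-Q : e ∈ Q → Among4 p q r s Q e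

  among4 : {p q r s e : A} {Q : List A} → e ∈ p ∷ q ∷ r ∷ s ∷ Q → Among4 p q r s Q e
  among4 (here eq)                         = is-p eq
  among4 (there (here eq))                 = is-q eq
  among4 (there (there (here eq)))         = is-r eq
  among4 (there (there (there (here eq)))) = is-s eq
  among4 (there (there (there (there m)))) = in-Q m

-- Lists of pairs, read as lists of passages (entering , leaving).  The passages of a circuit
-- partition use every half-edge exactly once, i.e. their list of endpoints is duplicate-free.
module _ {A : Set} where

  endpoints : List (A × A) → List A
  endpoints []             = []
  endpoints ((a , b) ∷ ps) = a ∷ b ∷ endpoints ps

  endpoints-++ : (ps qs : List (A × A)) → endpoints (ps ++ qs) ≡ endpoints ps ++ endpoints qs
  endpoints-++ []             qs = refl
  endpoints-++ ((a , b) ∷ ps) qs = cong (λ z → a ∷ b ∷ z) (endpoints-++ ps qs)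

  endpoint : Bool → A × A → A
  endpoint false = proj₁
  endpoint true  = proj₂

  endpoint-∈ : {p : A × A} {ps : List (A × A)} (c : Bool) → p ∈ ps → endpoint c p ∈ endpoints ps
  endpoint-∈ false (here refl) = here refl
  endpoint-∈ true  (here refl) = there (here refl)
  endpoint-∈ c (there m) = there (there (endpoint-∈ c m))

  endpoints-∈ : {z : A} (ps : List (A × A)) → z ∈ endpoints ps → ∃ λ p → (p ∈ ps) × ((proj₁ p ≡ z) ⊎ (proj₂ p ≡ z))
  endpoints-∈ ((a , b) ∷ ps) (here refl)         = (a , b) , here refl , inj₁ refl
  endpoints-∈ ((a , b) ∷ ps) (there (here refl)) = (a , b) , here refl , inj₂ refl
  endpoints-∈ ((a , b) ∷ ps) (there (there m)) with endpoints-∈ ps m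
  ... | p , p∈ , end = p , there p∈ , end

  endpoint-injective : {ps : List (A × A)} → Unique (endpoints ps) → {p q : A × A} → p ∈ ps → q ∈ ps →
    (c₁ c₂ : Bool) → endpoint c₁ p ≡ endpoint c₂ q → (p ≡ q) × (c₁ ≡ c₂)
  endpoint-injective ((a≢b ∷ _) ∷ _)   (here refl) (here refl) false false e = refl , refl
  endpoint-injective ((a≢b ∷ _) ∷ _)   (here refl) (here refl) false true  e = ⊥-elim (a≢b e)
  endpoint-injective ((a≢b ∷ _) ∷ _)   (here refl) (here refl) true  false e = ⊥-elim (a≢b (sym e))
  endpoint-injective ((a≢b ∷ _) ∷ _)   (here refl) (here refl) true  true  e = refl , refl
  endpoint-injective ((_ ∷ a∉) ∷ _)     (here refl) (there m) false c₂ e = ⊥-elim (All-lookup a∉ (endpoint-∈ c₂ m) e)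
  endpoint-injective (_ ∷ (b∉ ∷ _))     (here refl) (there m) true  c₂ e = ⊥-elim (All-lookup b∉ (endpoint-∈ c₂ m) e)
  endpoint-injective ((_ ∷ a∉) ∷ _)     (there m) (here refl) c₁ false e = ⊥-elim (All-lookup a∉ (endpoint-∈ c₁ m) (sym e))
  endpoint-injective (_ ∷ (b∉ ∷ _))     (there m) (here refl) c₁ true  e = ⊥-elim (All-lookup b∉ (endpoint-∈ c₁ m) (sym e))
  endpoint-injective (_ ∷ (_ ∷ u))      (there m₁) (there m₂) c₁ c₂ e = endpoint-injective u m₁ m₂ c₁ c₂ e

  module Endpoints {ps : List (A × A)} (u : Unique (endpoints ps)) where

    entry-injective : {p q : A × A} → p ∈ ps → q ∈ ps → proj₁ p ≡ proj₁ q → p ≡ q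
    entry-injective m₁ m₂ e = proj₁ (endpoint-injective u m₁ m₂ false false e)

    exit-injective : {p q : A × A} → p ∈ ps → q ∈ ps → proj₂ p ≡ proj₂ q → p ≡ q
    exit-injective m₁ m₂ e = proj₁ (endpoint-injective u m₁ m₂ true true e)

    entry≢exit : {p q : A × A} → p ∈ ps → q ∈ ps → proj₁ p ≢ proj₂ q
    entry≢exit m₁ m₂ e with endpoint-injective u m₁ m₂ false true e
    ... | _ , ()

    unique-pairs : Unique ps
    unique-pairs = go ps u
      where
      go : (qs : List (A × A)) → Unique (endpoints qs) → Unique qs
      go []             _                     = []
      go ((a , b) ∷ qs) ((_ ∷ a∉) ∷ (_ ∷ u′)) =
        tabulate (λ m eq → All-lookup a∉ (endpoint-∈ false m) (cong proj₁ eq)) ∷ go qs u′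

  Linked : List (A × A) → A → A → Set
  Linked ps a b = ((a , b) ∈ ps) ⊎ ((b , a) ∈ ps)

  linked-sym : {ps : List (A × A)} {a b : A} → Linked ps a b → Linked ps b a
  linked-sym (inj₁ m) = inj₂ m
  linked-sym (inj₂ m) = inj₁ m

  partner-unique : {ps : List (A × A)} → Unique (endpoints ps) → {a b c : A} → Linked ps a b → Linked ps a c → b ≡ c
  partner-unique u (inj₁ m₁) (inj₁ m₂) with Endpoints.entry-injective u m₁ m₂ refl
  ... | refl = refl
  partner-unique u (inj₁ m₁) (inj₂ m₂) = ⊥-elim (Endpoints.entry≢exit u m₁ m₂ refl)
  partner-unique u (inj₂ m₁) (inj₁ m₂) = ⊥-elim (Endpoints.entry≢exit u m₂ m₁ refl)
  partner-unique u (inj₂ m₁) (inj₂ m₂) with Endpoints.exit-injective u m₁ m₂ refl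
  ... | refl = refl

module _ {A : Set} where

  InOrder : List A → A → A → A → A → Set
  InOrder ys a b c d = ∃[ l₁ ] ∃[ l₂ ] ∃[ l₃ ] ∃[ l₄ ] ∃[ l₅ ] (ys ≡ l₁ ++ a ∷ l₂ ++ b ∷ l₃ ++ c ∷ l₄ ++ d ∷ l₅)

  private
    ∈-++-comm : {z : A} (r₁ r₂ : List A) → z ∈ r₂ ++ r₁ → z ∈ r₁ ++ r₂
    ∈-++-comm r₁ r₂ m with ∈-++⁻ r₂ m
    ... | inj₁ m₂ = ∈-++⁺ʳ r₁ m₂
    ... | inj₂ m₁ = ∈-++⁺ˡ m₁

    ++-split : (r₁ r₂ u v : List A) → r₁ ++ r₂ ≡ u ++ v →
      (∃ λ k → (u ≡ r₁ ++ k) × (r₂ ≡ k ++ v)) ⊎ (∃ λ k → (r₁ ≡ u ++ k) × (v ≡ k ++ r₂))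
    ++-split []       r₂ u       v e = inj₁ (u , refl , e)
    ++-split (x ∷ r₁) r₂ []      v e = inj₂ (x ∷ r₁ , refl , sym e)
    ++-split (x ∷ r₁) r₂ (y ∷ u) v e with ∷-injective e
    ... | refl , e′ with ++-split r₁ r₂ u v e′
    ... | inj₁ (k , e₁ , e₂) = inj₁ (k , cong (x ∷_) e₁ , e₂)
    ... | inj₂ (k , e₁ , e₂) = inj₂ (k , cong (x ∷_) e₁ , e₂)

  cyclicOrder-∈ : {xs : List A} {a b c d : A} → CyclicOrder xs a b c d → (a ∈ xs) × (b ∈ xs) × (c ∈ xs) × (d ∈ xs)
  cyclicOrder-∈ {a = a} {b} {c} {d} ((r₁ , r₂) , refl , l₁ , l₂ , l₃ , l₄ , l₅ , e) =
    back a (∈-++⁺ʳ l₁ (here refl)) ,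
    back b (∈-++⁺ʳ l₁ (there (∈-++⁺ʳ l₂ (here refl)))) ,
    back c (∈-++⁺ʳ l₁ (there (∈-++⁺ʳ l₂ (there (∈-++⁺ʳ l₃ (here refl)))))) ,
    back d (∈-++⁺ʳ l₁ (there (∈-++⁺ʳ l₂ (there (∈-++⁺ʳ l₃ (there (∈-++⁺ʳ l₄ (here refl))))))))
    where
    back : (z : A) → z ∈ l₁ ++ a ∷ l₂ ++ b ∷ l₃ ++ c ∷ l₄ ++ d ∷ l₅ → z ∈ r₁ ++ r₂
    back z m = ∈-++-comm r₁ r₂ (subst (z ∈_) (sym e) m)

  cyclicOrder-rotate : (u v : List A) {a b c d : A} → CyclicOrder (u ++ v) a b c d → CyclicOrder (v ++ u) a b c d
  cyclicOrder-rotate u v ((r₁ , r₂) , e , order) with ++-split r₁ r₂ u v e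
  ... | inj₁ (k , refl , refl) =
    ((v ++ r₁) , k) , ++-assoc v r₁ k , subst (λ z → InOrder z _ _ _ _) (++-assoc k v r₁) order
  ... | inj₂ (k , refl , refl) =
    (k , (r₂ ++ u)) , sym (++-assoc k r₂ u) , subst (λ z → InOrder z _ _ _ _) (sym (++-assoc r₂ u k)) order

-- Cyclic orders of labelled entries correspond exactly to cyclic orders of their labels, as
-- long as f is injective on the list.
module _ {A B : Set} (f : A → Maybe B) where

  mapMaybe-∷-just : {x : A} {y : B} (xs : List A) → f x ≡ just y → mapMaybe f (x ∷ xs) ≡ y ∷ mapMaybe f xs
  mapMaybe-∷-just xs fx = cong (λ m → maybe′ _∷_ (λ r → r) m (mapMaybe f xs)) fx

  mapMaybe-∷-nothing : {x : A} (xs : List A) → f x ≡ nothing → mapMaybe f (x ∷ xs) ≡ mapMaybe f xs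
  mapMaybe-∷-nothing xs fx = cong (λ m → maybe′ _∷_ (λ r → r) m (mapMaybe f xs)) fx

  data LabelCase (x : A) : Set where
    labelled   : (y : B) → f x ≡ just y → LabelCase x
    unlabelled : f x ≡ nothing → LabelCase x

  label-case : (x : A) → LabelCase x
  label-case x with f x in fx
  ... | just y  = labelled y fx
  ... | nothing = unlabelled fx

  mapMaybe-middle : (l : List A) {a : A} {s : B} (r : List A) → f a ≡ just s →
    mapMaybe f (l ++ a ∷ r) ≡ mapMaybe f l ++ s ∷ mapMaybe f r
  mapMaybe-middle l r fa = trans (mapMaybe-++ f l (_ ∷ r)) (cong (mapMaybe f l ++_) (mapMaybe-∷-just r fa))

  mapMaybe-inOrder : (l₁ l₂ l₃ l₄ l₅ : List A) {a b c d : A} {sa sb sc sd : B} →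
    f a ≡ just sa → f b ≡ just sb → f c ≡ just sc → f d ≡ just sd →
    mapMaybe f (l₁ ++ a ∷ l₂ ++ b ∷ l₃ ++ c ∷ l₄ ++ d ∷ l₅) ≡
      mapMaybe f l₁ ++ sa ∷ mapMaybe f l₂ ++ sb ∷ mapMaybe f l₃ ++ sc ∷ mapMaybe f l₄ ++ sd ∷ mapMaybe f l₅
  mapMaybe-inOrder l₁ l₂ l₃ l₄ l₅ fa fb fc fd =
    trans (mapMaybe-middle l₁ _ fa) (cong (λ z → mapMaybe f l₁ ++ _ ∷ z)
    (trans (mapMaybe-middle l₂ _ fb) (cong (λ z → mapMaybe f l₂ ++ _ ∷ z)
    (trans (mapMaybe-middle l₃ _ fc) (cong (λ z → mapMaybe f l₃ ++ _ ∷ z)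
    (mapMaybe-middle l₄ _ fd))))))

  cyclicOrder-relabel : {xs : List A} {a b c d : A} {sa sb sc sd : B} →
    f a ≡ just sa → f b ≡ just sb → f c ≡ just sc → f d ≡ just sd →
    CyclicOrder xs a b c d → CyclicOrder (mapMaybe f xs) sa sb sc sd
  cyclicOrder-relabel fa fb fc fd ((r₁ , r₂) , refl , l₁ , l₂ , l₃ , l₄ , l₅ , e) =
    (mapMaybe f r₁ , mapMaybe f r₂) , sym (mapMaybe-++ f r₁ r₂) ,
    mapMaybe f l₁ , mapMaybe f l₂ , mapMaybe f l₃ , mapMaybe f l₄ , mapMaybe f l₅ ,
    trans (sym (mapMaybe-++ f r₂ r₁)) (trans (cong (mapMaybe f) e) (mapMaybe-inOrder l₁ l₂ l₃ l₄ l₅ fa fb fc fd))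

  mapMaybe-split : (L : List A) (u v : List B) → mapMaybe f L ≡ u ++ v →
    ∃₂ λ U V → (L ≡ U ++ V) × (mapMaybe f U ≡ u) × (mapMaybe f V ≡ v)
  mapMaybe-split [] [] [] e = [] , [] , refl , refl , refl
  mapMaybe-split (x ∷ L) u v e with label-case x
  ... | unlabelled fx with mapMaybe-split L u v (trans (sym (mapMaybe-∷-nothing L fx)) e)
  ...   | U , V , refl , e₁ , e₂ = x ∷ U , V , refl , trans (mapMaybe-∷-nothing U fx) e₁ , e₂
  mapMaybe-split (x ∷ L) [] v e | labelled t fx =
    [] , x ∷ L , refl , refl , e
  mapMaybe-split (x ∷ L) (t′ ∷ u) v e | labelled t fx with ∷-injective (trans (sym (mapMaybe-∷-just L fx)) e)
  ... | refl , e′ with mapMaybe-split L u v e′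
  ...   | U , V , refl , e₁ , e₂ = x ∷ U , V , refl , trans (mapMaybe-∷-just U fx) (cong (t ∷_) e₁) , e₂

  mapMaybe-split-at : (L : List A) (u : List B) (s : B) (v : List B) → mapMaybe f L ≡ u ++ s ∷ v →
    ∃[ U ] ∃[ e ] ∃[ V ] ((L ≡ U ++ e ∷ V) × (mapMaybe f U ≡ u) × (f e ≡ just s) × (mapMaybe f V ≡ v))
  mapMaybe-split-at [] [] s v ()
  mapMaybe-split-at [] (_ ∷ _) s v ()
  mapMaybe-split-at (x ∷ L) u s v e with label-case x
  ... | unlabelled fx with mapMaybe-split-at L u s v (trans (sym (mapMaybe-∷-nothing L fx)) e)
  ...   | U , e₀ , V , refl , e₁ , e₂ , e₃ = x ∷ U , e₀ , V , refl , trans (mapMaybe-∷-nothing U fx) e₁ , e₂ , e₃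
  mapMaybe-split-at (x ∷ L) [] s v e | labelled t fx with ∷-injective (trans (sym (mapMaybe-∷-just L fx)) e)
  ... | refl , e′ = [] , x , L , refl , refl , fx , e′
  mapMaybe-split-at (x ∷ L) (t′ ∷ u) s v e | labelled t fx with ∷-injective (trans (sym (mapMaybe-∷-just L fx)) e)
  ... | refl , e′ with mapMaybe-split-at L u s v e′
  ...   | U , e₀ , V , refl , e₁ , e₂ , e₃ =
    x ∷ U , e₀ , V , refl , trans (mapMaybe-∷-just U fx) (cong (t ∷_) e₁) , e₂ , e₃

  cyclicOrder-unrelabel : {xs : List A} {sa sb sc sd : B} → CyclicOrder (mapMaybe f xs) sa sb sc sd →
    ∃[ a ] ∃[ b ] ∃[ c ] ∃[ d ] ((f a ≡ just sa) × (f b ≡ just sb) × (f c ≡ just sc) × (f d ≡ just sd) ×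
      CyclicOrder xs a b c d)
  cyclicOrder-unrelabel {xs} {sa} {sb} {sc} {sd} ((r₁ , r₂) , e₀ , l₁ , l₂ , l₃ , l₄ , l₅ , e)
    with mapMaybe-split xs r₁ r₂ (sym e₀)
  ... | R₁ , R₂ , refl , m₁ , m₂
    with mapMaybe-split-at (R₂ ++ R₁) l₁ sa (l₂ ++ sb ∷ l₃ ++ sc ∷ l₄ ++ sd ∷ l₅)
           (trans (mapMaybe-++ f R₂ R₁) (trans (cong₂ _++_ m₂ m₁) e))
  ... | U₁ , a , V₁ , q , _ , fa , k₁
    with mapMaybe-split-at V₁ l₂ sb (l₃ ++ sc ∷ l₄ ++ sd ∷ l₅) k₁
  ... | U₂ , b , V₂ , refl , _ , fb , k₂
    with mapMaybe-split-at V₂ l₃ sc (l₄ ++ sd ∷ l₅) k₂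
  ... | U₃ , c , V₃ , refl , _ , fc , k₃
    with mapMaybe-split-at V₃ l₄ sd l₅ k₃
  ... | U₄ , d , V₄ , refl , _ , fd , _ =
    a , b , c , d , fa , fb , fc , fd , (R₁ , R₂) , refl , U₁ , U₂ , U₃ , U₄ , V₄ , q

  mapMaybe-preimage : (L : List A) {t : B} → t ∈ mapMaybe f L → ∃ λ e → (e ∈ L) × (f e ≡ just t)
  mapMaybe-preimage (x ∷ L) m with label-case x
  ... | unlabelled fx with mapMaybe-preimage L (subst (_ ∈_) (mapMaybe-∷-nothing L fx) m)
  ...   | e , i , q = e , there i , q
  mapMaybe-preimage (x ∷ L) m | labelled s fx with subst (_ ∈_) (mapMaybe-∷-just L fx) m
  ... | here refl = x , here refl , fx
  ... | there m′ with mapMaybe-preimage L m′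
  ...   | e , i , q = e , there i , q

  mapMaybe-∈ : (L : List A) {e : A} {s : B} → e ∈ L → f e ≡ just s → s ∈ mapMaybe f L
  mapMaybe-∈ (x ∷ L) (here refl) fe = subst (_ ∈_) (sym (mapMaybe-∷-just L fe)) (here refl)
  mapMaybe-∈ (x ∷ L) (there i) fe with label-case x
  ... | unlabelled fx = subst (_ ∈_) (sym (mapMaybe-∷-nothing L fx)) (mapMaybe-∈ L i fe)
  ... | labelled _ fx = subst (_ ∈_) (sym (mapMaybe-∷-just L fx)) (there (mapMaybe-∈ L i fe))

  unique-mapMaybe : (L : List A) → Unique L →
    (∀ {e₁ e₂ s} → e₁ ∈ L → e₂ ∈ L → f e₁ ≡ just s → f e₂ ≡ just s → e₁ ≡ e₂) → Unique (mapMaybe f L)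
  unique-mapMaybe [] u inj = []
  unique-mapMaybe (x ∷ L) (x∉ ∷ u) inj with label-case x
  ... | unlabelled fx = subst Unique (sym (mapMaybe-∷-nothing L fx)) (unique-mapMaybe L u (λ i₁ i₂ → inj (there i₁) (there i₂)))
  ... | labelled s fx = subst Unique (sym (mapMaybe-∷-just L fx))
        (tabulate s∉ ∷ unique-mapMaybe L u (λ i₁ i₂ → inj (there i₁) (there i₂)))
    where
    s∉ : ∀ {t} → t ∈ mapMaybe f L → s ≢ t
    s∉ m refl with mapMaybe-preimage L m
    ... | e , i , q = All-lookup x∉ i (inj (here refl) (there i) fx q)

module CyclicOrderDecision {A : Set} (_≟_ : DecidableEquality A) where

  private
    ⊑-cons⁻ : {s : A} {ss xs : List A} → (s ∷ ss) ⊑ xs → ∃₂ λ l r → (xs ≡ l ++ s ∷ r) × ss ⊑ r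
    ⊑-cons⁻ (refl ∷ p) = [] , _ , refl , p
    ⊑-cons⁻ (skip x p) with ⊑-cons⁻ p
    ... | l , r , refl , q = x ∷ l , r , refl , q

    []⊑ : (xs : List A) → [] ⊑ xs
    []⊑ []       = []
    []⊑ (x ∷ xs) = skip x ([]⊑ xs)

    ⊑-cons⁺ : {s : A} {ss : List A} (l r : List A) → ss ⊑ r → (s ∷ ss) ⊑ (l ++ s ∷ r)
    ⊑-cons⁺ []      r p = refl ∷ p
    ⊑-cons⁺ (x ∷ l) r p = skip x (⊑-cons⁺ l r p)

    inOrder→⊑ : {ys : List A} {a b c d : A} → InOrder ys a b c d → (a ∷ b ∷ c ∷ d ∷ []) ⊑ ys
    inOrder→⊑ (l₁ , l₂ , l₃ , l₄ , l₅ , refl) = ⊑-cons⁺ l₁ _ (⊑-cons⁺ l₂ _ (⊑-cons⁺ l₃ _ (⊑-cons⁺ l₄ _ ([]⊑ l₅))))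

    ⊑→inOrder : {ys : List A} {a b c d : A} → (a ∷ b ∷ c ∷ d ∷ []) ⊑ ys → InOrder ys a b c d
    ⊑→inOrder p with ⊑-cons⁻ p
    ... | l₁ , _ , refl , p₁ with ⊑-cons⁻ p₁
    ... | l₂ , _ , refl , p₂ with ⊑-cons⁻ p₂
    ... | l₃ , _ , refl , p₃ with ⊑-cons⁻ p₃
    ... | l₄ , l₅ , refl , _ = l₁ , l₂ , l₃ , l₄ , l₅ , refl

  -- Greedy left-to-right search for a sublist; correct for the sublist relation.
  isSublist : List A → List A → Bool
  isSublist []       _        = true
  isSublist (s ∷ ss) []       = false
  isSublist (s ∷ ss) (x ∷ xs) with s ≟ x
  ... | yes _ = isSublist ss xs
  ... | no _  = isSublist (s ∷ ss) xs

  private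
    isSublist-sound : (ss xs : List A) → T (isSublist ss xs) → ss ⊑ xs
    isSublist-sound []       xs       _ = []⊑ xs
    isSublist-sound (s ∷ ss) (x ∷ xs) t with s ≟ x
    ... | yes refl = refl ∷ isSublist-sound ss xs t
    ... | no _     = skip x (isSublist-sound (s ∷ ss) xs t)

    ⊑-drop : {s : A} {ss xs : List A} → (s ∷ ss) ⊑ xs → ss ⊑ xs
    ⊑-drop (refl ∷ p) = skip _ p
    ⊑-drop (skip x p) = skip x (⊑-drop p)

    isSublist-complete : (ss xs : List A) → ss ⊑ xs → T (isSublist ss xs)
    isSublist-complete []       xs       _ = tt
    isSublist-complete (s ∷ ss) (x ∷ xs) p with s ≟ x
    isSublist-complete (s ∷ ss) (x ∷ xs) (refl ∷ p) | yes refl = isSublist-complete ss xs p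
    isSublist-complete (s ∷ ss) (x ∷ xs) (skip _ p) | yes refl = isSublist-complete ss xs (⊑-drop p)
    isSublist-complete (s ∷ ss) (x ∷ xs) (refl ∷ p) | no s≢x  = ⊥-elim (s≢x refl)
    isSublist-complete (s ∷ ss) (x ∷ xs) (skip _ p) | no _    = isSublist-complete (s ∷ ss) xs p

  Split : (List A → List A → Set) → List A → Set
  Split R xs = Σ (List A × List A) λ r → (proj₁ r ++ proj₂ r ≡ xs) × R (proj₁ r) (proj₂ r)

  anySplit : (List A → List A → Bool) → List A → Bool
  anySplit f []       = f [] []
  anySplit f (x ∷ xs) with f [] (x ∷ xs)
  ... | true  = true
  ... | false = anySplit (λ a b → f (x ∷ a) b) xs

  private
    anySplit-sound : (f : List A → List A → Bool) (xs : List A) → T (anySplit f xs) → Split (λ r₁ r₂ → T (f r₁ r₂)) xs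
    anySplit-sound f []       t = ([] , []) , refl , t
    anySplit-sound f (x ∷ xs) t with f [] (x ∷ xs) in eq
    ... | true  = ([] , x ∷ xs) , refl , subst T (sym eq) tt
    ... | false with anySplit-sound (λ a b → f (x ∷ a) b) xs t
    ...   | (r₁ , r₂) , refl , t′ = (x ∷ r₁ , r₂) , refl , t′

    anySplit-complete : (f : List A → List A → Bool) (r₁ r₂ : List A) → T (f r₁ r₂) → T (anySplit f (r₁ ++ r₂))
    anySplit-complete f []       []       t = t
    anySplit-complete f []       (x ∷ r₂) t with f [] (x ∷ r₂)
    ... | true  = tt
    anySplit-complete f (x ∷ r₁) r₂       t with f [] (x ∷ r₁ ++ r₂)
    ... | true  = tt
    ... | false = anySplit-complete (λ a b → f (x ∷ a) b) r₁ r₂ t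

  cyclicOrder? : (xs : List A) (a b c d : A) → Dec (CyclicOrder xs a b c d)
  cyclicOrder? xs a b c d with anySplit (λ r₁ r₂ → isSublist (a ∷ b ∷ c ∷ d ∷ []) (r₂ ++ r₁)) xs in eq
  ... | true  = yes (witness (anySplit-sound _ xs (subst T (sym eq) tt)))
    where
    witness : Split (λ r₁ r₂ → T (isSublist (a ∷ b ∷ c ∷ d ∷ []) (r₂ ++ r₁))) xs → CyclicOrder xs a b c d
    witness (r , split , t) = r , split , ⊑→inOrder (isSublist-sound _ _ t)
  ... | false =
    no λ { ((r₁ , r₂) , refl , o) → subst T eq (anySplit-complete _ r₁ r₂ (isSublist-complete _ _ (inOrder→⊑ o))) }

  sign : {P Q : Set} → Dec P → Dec Q → ℤ
  sign (yes _) _       = + 1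
  sign (no _)  (yes _) = -[1+ 0 ]
  sign (no _)  (no _)  = + 0

  sign-cong : {P P′ Q Q′ : Set} → (P → P′) → (P′ → P) → (Q → Q′) → (Q′ → Q) →
    (d₁ : Dec P) (d₂ : Dec Q) (d₁′ : Dec P′) (d₂′ : Dec Q′) → sign d₁ d₂ ≡ sign d₁′ d₂′
  sign-cong f g h k (yes p)  _        (yes _)   _        = refl
  sign-cong f g h k (yes p)  _        (no ¬p′)  _        = ⊥-elim (¬p′ (f p))
  sign-cong f g h k (no ¬p)  _        (yes p′)  _        = ⊥-elim (¬p (g p′))
  sign-cong f g h k (no _)   (yes _)  (no _)    (yes _)  = refl
  sign-cong f g h k (no _)   (yes q)  (no _)    (no ¬q′) = ⊥-elim (¬q′ (h q))
  sign-cong f g h k (no _)   (no ¬q)  (no _)    (yes q′) = ⊥-elim (¬q (k q′))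
  sign-cong f g h k (no _)   (no _)   (no _)    (no _)   = refl

  sign-0 : {P Q : Set} → ¬ P → ¬ Q → (d₁ : Dec P) (d₂ : Dec Q) → sign d₁ d₂ ≡ + 0
  sign-0 ¬p ¬q (yes p) _       = ⊥-elim (¬p p)
  sign-0 ¬p ¬q (no _)  (yes q) = ⊥-elim (¬q q)
  sign-0 ¬p ¬q (no _)  (no _)  = refl

  -- The interlacement value of the letter pairs (s⁺ , s⁻) and (t⁺ , t⁻) on the cyclic word W:
  -- +1 for the cyclic order s⁺ t⁻ s⁻ t⁺, −1 for s⁺ t⁺ s⁻ t⁻, 0 otherwise (as for I_R).
  interlace : List A → A → A → A → A → ℤ
  interlace W s⁺ s⁻ t⁺ t⁻ = sign (cyclicOrder? W s⁺ t⁻ s⁻ t⁺) (cyclicOrder? W s⁺ t⁺ s⁻ t⁻)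

  interlace-rotate : (u v : List A) (s⁺ s⁻ t⁺ t⁻ : A) → interlace (u ++ v) s⁺ s⁻ t⁺ t⁻ ≡ interlace (v ++ u) s⁺ s⁻ t⁺ t⁻
  interlace-rotate u v _ _ _ _ =
    sign-cong (cyclicOrder-rotate u v) (cyclicOrder-rotate v u) (cyclicOrder-rotate u v) (cyclicOrder-rotate v u) _ _ _ _

  interlace-absent : (W : List A) (s⁺ s⁻ t⁺ t⁻ : A) → ¬ (t⁺ ∈ W) → interlace W s⁺ s⁻ t⁺ t⁻ ≡ + 0
  interlace-absent W s⁺ s⁻ t⁺ t⁻ t⁺∉W =
    sign-0 (λ o → t⁺∉W (proj₂ (proj₂ (proj₂ (cyclicOrder-∈ o))))) (λ o → t⁺∉W (proj₁ (proj₂ (cyclicOrder-∈ o)))) _ _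

module _ {G : Graph} where

  _≟ʰ_ : DecidableEquality (HalfEdge G)
  he e b ≟ʰ he e′ b′ with e ≟ᶠ e′ | b ≟ᵇ b′
  ... | yes refl | yes refl = yes refl
  ... | no e≢e′  | _        = no λ { refl → e≢e′ refl }
  ... | yes refl | no b≢b′  = no λ { refl → b≢b′ refl }

  _≟ᵖ_ : DecidableEquality (Passage G)
  _≟ᵖ_ = ≡-dec _≟ʰ_ _≟ʰ_

  dartEnds : Dart G → List (HalfEdge G)
  dartEnds d = tailHE d ∷ headHE d ∷ []

  endpoints-passages : (ds : List (Dart G)) → endpoints (passages ds) ↭ concatMap dartEnds ds
  endpoints-passages []       = ↭-refl
  endpoints-passages (d ∷ ds) =
    ↭-trans (↭-reflexive (walk d ds d))
    (↭-trans (shift (tailHE d) (headHE d ∷ concatMap dartEnds ds) [])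
    (↭-reflexive (cong (λ z → tailHE d ∷ headHE d ∷ z) (++-identityʳ (concatMap dartEnds ds)))))
    where
    walk : (d : Dart G) (ds : List (Dart G)) (n : Dart G) →
      endpoints (zipWith (λ a b → (headHE a , tailHE b)) (d ∷ ds) (ds ++ [ n ])) ≡
        headHE d ∷ concatMap dartEnds ds ++ tailHE n ∷ []
    walk d []        n = refl
    walk d (d′ ∷ ds) n = cong (λ z → headHE d ∷ tailHE d′ ∷ z) (walk d′ ds n)

  endpoints-allPassages : (cs : List (List (Dart G))) → endpoints (allPassages cs) ↭ concatMap dartEnds (concat cs)
  endpoints-allPassages []       = ↭-refl
  endpoints-allPassages (c ∷ cs) =
    ↭-trans (↭-reflexive (endpoints-++ (passages c) (allPassages cs)))
    (↭-trans (++⁺ (endpoints-passages c) (endpoints-allPassages cs))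
    (↭-reflexive (sym (concatMap-++ dartEnds c (concat cs)))))

  private
    dartEnds-edge : (ds : List (Dart G)) {z : HalfEdge G} → z ∈ concatMap dartEnds ds → hedge z ∈ map dedge ds
    dartEnds-edge (d ∷ ds) (here refl)         = here refl
    dartEnds-edge (d ∷ ds) (there (here refl)) = here refl
    dartEnds-edge (d ∷ ds) (there (there m))   = there (dartEnds-edge ds m)

    not≢ : (b : Bool) → b ≢ not b
    not≢ false ()
    not≢ true  ()

    edgesOf-concat : (cs : List (List (Dart G))) → edgesOf cs ≡ map dedge (concat cs)
    edgesOf-concat []       = refl
    edgesOf-concat (c ∷ cs) = trans (cong (map dedge c ++_) (edgesOf-concat cs)) (sym (map-++ dedge c (concat cs)))

  unique-dartEnds : (ds : List (Dart G)) → Unique (map dedge ds) → Unique (concatMap dartEnds ds)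
  unique-dartEnds []              _          = []
  unique-dartEnds (dart e b ∷ ds) (e∉ ∷ u) =
    ((λ eq → not≢ b (cong hend eq)) ∷ other) ∷ (other ∷ unique-dartEnds ds u)
    where
    other : {b′ : Bool} → All (he e b′ ≢_) (concatMap dartEnds ds)
    other = tabulate (λ m eq → All-lookup e∉ (dartEnds-edge ds m) (cong hedge eq))

  partition-unique-ends : (cs : List (List (Dart G))) → edgesOf cs ↭ allFin (nE G) → Unique (endpoints (allPassages cs))
  partition-unique-ends cs p =
    unique-↭ (↭-sym (endpoints-allPassages cs))
      (unique-dartEnds (concat cs) (subst Unique (edgesOf-concat cs) (unique-↭ (↭-sym p) (allFin⁺ (nE G)))))

  partition-covers : (cs : List (List (Dart G))) → edgesOf cs ↭ allFin (nE G) → (h : HalfEdge G) → h ∈ endpoints (allPassages cs)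
  partition-covers cs p (he e b) with ∈-map⁻ dedge (subst (e ∈_) (edgesOf-concat cs) (∈-resp-↭ (↭-sym p) (∈-allFin e)))
  ... | dart e b′ , i , refl = ∈-resp-↭ (↭-sym (endpoints-allPassages cs)) (∈-concatMap-intro dartEnds i (end b b′))
    where
    end : (b b′ : Bool) → he e b ∈ dartEnds (dart e b′)
    end false false = here refl
    end true  true  = here refl
    end false true  = there (here refl)
    end true  false = there (here refl)

  passage-local : (cs : List (List (Dart G))) → All (IsCircuit G) cs → {p : Passage G} → p ∈ allPassages cs →
    vtx G (proj₁ p) ≡ vtx G (proj₂ p)
  passage-local cs circ m with ∈-concatMap-elim passages m
  ... | c , c∈ , m′ = All-lookup (proj₂ (All-lookup circ c∈)) m′

  passage-vertex : (ds : List (Dart G)) {p : Passage G} → p ∈ passages ds → vtx G (proj₂ p) ∈ verticesOf {G} ds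
  passage-vertex (d ∷ ds) m with zipWith-∈ (d ∷ ds) (ds ++ [ d ]) m
    where
    zipWith-∈ : (xs ys : List (Dart G)) {p : Passage G} → p ∈ zipWith (λ a b → (headHE a , tailHE b)) xs ys →
      ∃₂ λ a b → (b ∈ ys) × (p ≡ (headHE a , tailHE b))
    zipWith-∈ (x ∷ xs) (y ∷ ys) (here refl) = x , y , here refl , refl
    zipWith-∈ (x ∷ xs) (y ∷ ys) (there m) with zipWith-∈ xs ys m
    ... | a , b , i , e = a , b , there i , e
  ... | a , b , j , refl = ∈-map⁺ (λ d → vtx G (tailHE d)) (rotate j)
    where
    rotate : b ∈ ds ++ [ d ] → b ∈ d ∷ ds
    rotate j with ∈-++⁻ ds j
    ... | inj₁ j′         = there j′
    ... | inj₂ (here refl) = here refl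

  private
    forward : Fin (nE G) → Dart G
    forward e = dart e false

    unique-allHalfEdges : Unique (allHalfEdges G)
    unique-allHalfEdges = subst Unique (concatMap-map dartEnds forward (allFin (nE G)))
      (unique-dartEnds (map forward (allFin (nE G))) (subst Unique (sym (edges (allFin (nE G)))) (allFin⁺ (nE G))))
      where
      edges : (es : List (Fin (nE G))) → map dedge (map forward es) ≡ es
      edges []       = refl
      edges (e ∷ es) = cong (e ∷_) (edges es)

    ∈-allHalfEdges : (h : HalfEdge G) → h ∈ allHalfEdges G
    ∈-allHalfEdges (he e false) = ∈-concatMap-intro (λ e → he e false ∷ he e true ∷ []) (∈-allFin e) (here refl)
    ∈-allHalfEdges (he e true)  = ∈-concatMap-intro (λ e → he e false ∷ he e true ∷ []) (∈-allFin e) (there (here refl))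

    at : Fin (nV G) → List (HalfEdge G)
    at y = filter (λ h → vtx G h ≟ᶠ y) (allHalfEdges G)

    ∈-at : {y : Fin (nV G)} (h : HalfEdge G) → vtx G h ≡ y → h ∈ at y
    ∈-at h e = ∈-filter⁺ (λ h → vtx G h ≟ᶠ _) (∈-allHalfEdges h) e

  record Distinct4 (h₁ h₂ h₃ h₄ : HalfEdge G) : Set where
    field
      n₁₂ : h₁ ≢ h₂
      n₁₃ : h₁ ≢ h₃
      n₁₄ : h₁ ≢ h₄
      n₂₃ : h₂ ≢ h₃
      n₂₄ : h₂ ≢ h₄
      n₃₄ : h₃ ≢ h₄

  module Degree (FR : FourRegular G) where

    no-five : {y : Fin (nV G)} (h₁ h₂ h₃ h₄ h₅ : HalfEdge G) →
      vtx G h₁ ≡ y → vtx G h₂ ≡ y → vtx G h₃ ≡ y → vtx G h₄ ≡ y → vtx G h₅ ≡ y →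
      h₁ ≢ h₂ → h₁ ≢ h₃ → h₁ ≢ h₄ → h₁ ≢ h₅ → h₂ ≢ h₃ → h₂ ≢ h₄ → h₂ ≢ h₅ →
      h₃ ≢ h₄ → h₃ ≢ h₅ → h₄ ≢ h₅ → ⊥
    no-five {y} h₁ h₂ h₃ h₄ h₅ y₁ y₂ y₃ y₄ y₅ n₁₂ n₁₃ n₁₄ n₁₅ n₂₃ n₂₄ n₂₅ n₃₄ n₃₅ n₄₅ =
      5≰4 (subst (5 ≤_) (FR y) (unique-length-≤ (at y) distinct sub))
      where
      distinct : Unique (h₁ ∷ h₂ ∷ h₃ ∷ h₄ ∷ h₅ ∷ [])
      distinct = (n₁₂ ∷ n₁₃ ∷ n₁₄ ∷ n₁₅ ∷ []) ∷ (n₂₃ ∷ n₂₄ ∷ n₂₅ ∷ []) ∷ (n₃₄ ∷ n₃₅ ∷ []) ∷ (n₄₅ ∷ [])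
               ∷ [] ∷ []
      sub : ∀ {z} → z ∈ h₁ ∷ h₂ ∷ h₃ ∷ h₄ ∷ h₅ ∷ [] → z ∈ at y
      sub (here refl)                                 = ∈-at _ y₁
      sub (there (here refl))                         = ∈-at _ y₂
      sub (there (there (here refl)))                 = ∈-at _ y₃
      sub (there (there (there (here refl))))         = ∈-at _ y₄
      sub (there (there (there (there (here refl))))) = ∈-at _ y₅
      5≰4 : ¬ (5 ≤ 4)
      5≰4 (s≤s (s≤s (s≤s (s≤s ()))))

    only-four : {y : Fin (nV G)} {h₁ h₂ h₃ h₄ k : HalfEdge G} →
      vtx G h₁ ≡ y → vtx G h₂ ≡ y → vtx G h₃ ≡ y → vtx G h₄ ≡ y → Distinct4 h₁ h₂ h₃ h₄ → vtx G k ≡ y →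
      (k ≡ h₁) ⊎ (k ≡ h₂) ⊎ (k ≡ h₃) ⊎ (k ≡ h₄)
    only-four {h₁ = h₁} {h₂} {h₃} {h₄} {k} y₁ y₂ y₃ y₄ d yk with k ≟ʰ h₁ | k ≟ʰ h₂ | k ≟ʰ h₃ | k ≟ʰ h₄
    ... | yes e | _     | _     | _     = inj₁ e
    ... | no _  | yes e | _     | _     = inj₂ (inj₁ e)
    ... | no _  | no _  | yes e | _     = inj₂ (inj₂ (inj₁ e))
    ... | no _  | no _  | no _  | yes e = inj₂ (inj₂ (inj₂ e))
    ... | no k₁ | no k₂ | no k₃ | no k₄ =
      ⊥-elim (no-five h₁ h₂ h₃ h₄ k y₁ y₂ y₃ y₄ yk
                n₁₂ n₁₃ n₁₄ (≢-sym k₁) n₂₃ n₂₄ (≢-sym k₂) n₃₄ (≢-sym k₃) (≢-sym k₄))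
      where
      open Distinct4 d
      ≢-sym : {a b : HalfEdge G} → a ≢ b → b ≢ a
      ≢-sym a≢b b≡a = a≢b (sym b≡a)

    third : {y : Fin (nV G)} (h₁ h₂ : HalfEdge G) → ∃ λ k → (vtx G k ≡ y) × (k ≢ h₁) × (k ≢ h₂)
    third {y} h₁ h₂ with any? (λ k → ¬? (k ≟ʰ h₁) ×-dec ¬? (k ≟ʰ h₂)) (at y)
    ... | yes found with find found
    ...   | k , k∈ , k≢h₁ , k≢h₂ = k , proj₂ (∈-filter⁻ (λ h → vtx G h ≟ᶠ y) {xs = allHalfEdges G} k∈) , k≢h₁ , k≢h₂
    third {y} h₁ h₂ | no none =
      ⊥-elim (4≰2 (subst (_≤ 2) (FR y) (unique-length-≤ (h₁ ∷ h₂ ∷ []) (filter⁺ (λ h → vtx G h ≟ᶠ y) unique-allHalfEdges) sub)))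
      where
      sub : ∀ {z} → z ∈ at y → z ∈ h₁ ∷ h₂ ∷ []
      sub {z} m with z ≟ʰ h₁ | z ≟ʰ h₂
      ... | yes e    | _        = here e
      ... | no _     | yes e    = there (here e)
      ... | no z≢h₁  | no z≢h₂  = ⊥-elim (none (lose m (z≢h₁ , z≢h₂)))
      4≰2 : ¬ (4 ≤ 2)
      4≰2 (s≤s (s≤s ()))

record PassageSystem {G : Graph} (ps : List (Passage G)) : Set where
  field
    unique-ends : Unique (endpoints ps)
    local       : ∀ {p} → p ∈ ps → vtx G (proj₁ p) ≡ vtx G (proj₂ p)

partition-passageSystem : {G : Graph} (cs : List (List (Dart G))) → IsCircuitPartition G cs → PassageSystem (allPassages cs)
partition-passageSystem cs (circ , edges) = record
  { unique-ends = partition-unique-ends cs edges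
  ; local       = passage-local cs circ }

module Passages {G : Graph} (FR : FourRegular G) {ps : List (Passage G)} (S : PassageSystem ps) where
  open PassageSystem S
  open Degree {G} FR
  open Endpoints unique-ends

  no-three : {y : Fin (nV G)} {p q r : Passage G} → p ∈ ps → q ∈ ps → r ∈ ps →
    vtx G (proj₁ p) ≡ y → vtx G (proj₁ q) ≡ y → vtx G (proj₁ r) ≡ y → p ≢ q → p ≢ r → q ≢ r → ⊥
  no-three p∈ q∈ r∈ py qy ry p≢q p≢r q≢r =
    no-five _ _ _ _ _ py (trans (sym (local p∈)) py) qy (trans (sym (local q∈)) qy) ry
      (entry≢exit p∈ p∈) (λ e → p≢q (entry-injective p∈ q∈ e)) (entry≢exit p∈ q∈) (λ e → p≢r (entry-injective p∈ r∈ e))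
      (λ e → entry≢exit q∈ p∈ (sym e)) (λ e → p≢q (exit-injective p∈ q∈ e)) (λ e → entry≢exit r∈ p∈ (sym e))
      (entry≢exit q∈ q∈) (λ e → q≢r (entry-injective q∈ r∈ e)) (λ e → entry≢exit r∈ q∈ (sym e))

  partner : (∀ h → h ∈ endpoints ps) → (h : HalfEdge G) → ∃ λ k → Linked ps h k × (vtx G k ≡ vtx G h) × (k ≢ h)
  partner covers h with endpoints-∈ ps (covers h)
  ... | (_ , k) , m , inj₁ refl = k , inj₁ m , sym (local m) , λ e → entry≢exit m m (sym e)
  ... | (k , _) , m , inj₂ refl = k , inj₂ m , local m , entry≢exit m m

  transition : (∀ h → h ∈ endpoints ps) → {y : Fin (nV G)} {h₁ h₂ h₃ h₄ : HalfEdge G} →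
    vtx G h₁ ≡ y → vtx G h₂ ≡ y → vtx G h₃ ≡ y → vtx G h₄ ≡ y → Distinct4 h₁ h₂ h₃ h₄ →
    ¬ (Linked ps h₁ h₃ × Linked ps h₂ h₄) →
    (Linked ps h₁ h₂ × Linked ps h₃ h₄) ⊎ (Linked ps h₁ h₄ × Linked ps h₂ h₃)
  transition covers {h₁ = h₁} {h₂} {h₃} {h₄} y₁ y₂ y₃ y₄ d ¬ψ
    with partner covers h₁ | partner covers h₂ | partner covers h₃
  ... | k₁ , l₁ , z₁ , k₁≢h₁ | k₂ , l₂ , z₂ , k₂≢h₂ | k₃ , l₃ , z₃ , k₃≢h₃
    with only-four y₁ y₂ y₃ y₄ d (trans z₁ y₁)
  ... | inj₁ refl = ⊥-elim (k₁≢h₁ refl)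
  ... | inj₂ (inj₁ refl) with only-four y₁ y₂ y₃ y₄ d (trans z₃ y₃)
  ...   | inj₁ refl                = ⊥-elim (Distinct4.n₂₃ d (partner-unique unique-ends l₁ (linked-sym l₃)))
  ...   | inj₂ (inj₁ refl)         = ⊥-elim (Distinct4.n₁₃ d (partner-unique unique-ends (linked-sym l₁) (linked-sym l₃)))
  ...   | inj₂ (inj₂ (inj₁ refl))  = ⊥-elim (k₃≢h₃ refl)
  ...   | inj₂ (inj₂ (inj₂ refl))  = inj₁ (l₁ , l₃)
  transition covers y₁ y₂ y₃ y₄ d ¬ψ | _ , l₁ , _ | _ , l₂ , z₂ , k₂≢h₂ | _ | inj₂ (inj₂ (inj₁ refl))
    with only-four y₁ y₂ y₃ y₄ d (trans z₂ y₂)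
  ...   | inj₁ refl                = ⊥-elim (Distinct4.n₂₃ d (partner-unique unique-ends (linked-sym l₂) l₁))
  ...   | inj₂ (inj₁ refl)         = ⊥-elim (k₂≢h₂ refl)
  ...   | inj₂ (inj₂ (inj₁ refl))  = ⊥-elim (Distinct4.n₁₂ d (partner-unique unique-ends (linked-sym l₁) (linked-sym l₂)))
  ...   | inj₂ (inj₂ (inj₂ refl))  = ⊥-elim (¬ψ (l₁ , l₂))
  transition covers y₁ y₂ y₃ y₄ d ¬ψ | _ , l₁ , _ | _ , l₂ , z₂ , k₂≢h₂ | _ | inj₂ (inj₂ (inj₂ refl))
    with only-four y₁ y₂ y₃ y₄ d (trans z₂ y₂)
  ...   | inj₁ refl                = ⊥-elim (Distinct4.n₂₄ d (partner-unique unique-ends (linked-sym l₂) l₁))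
  ...   | inj₂ (inj₁ refl)         = ⊥-elim (k₂≢h₂ refl)
  ...   | inj₂ (inj₂ (inj₁ refl))  = inj₂ (l₁ , l₂)
  ...   | inj₂ (inj₂ (inj₂ refl))  = ⊥-elim (Distinct4.n₁₂ d (partner-unique unique-ends (linked-sym l₁) (linked-sym l₂)))

plus-unique : {G : Graph} {S : SignedSys G} → Unique (endpoints (allPassages (circuits S))) →
  {x : Fin (nV G)} {p q : Passage G} → IsPlus S x p → IsPlus S x q → p ≡ q
plus-unique u (p∈ , p⁺) (q∈ , q⁺) = Endpoints.entry-injective u p∈ q∈ (trans p⁺ (sym q⁺))

module Signed {G : Graph} (FR : FourRegular G) (S : SignedSys G) (PS : PassageSystem (allPassages (circuits S)))
              (plus-at : ∀ v → vtx G (plus S v) ≡ v) where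
  open PassageSystem PS
  open Passages FR PS
  open Endpoints unique-ends

  minus-unique : {x : Fin (nV G)} {r p q : Passage G} → IsPlus S x r → IsMinus S x p → IsMinus S x q → p ≡ q
  minus-unique {x} {r} {p} {q} (r∈ , r⁺) (p∈ , px , p≢) (q∈ , qx , q≢) with p ≟ᵖ q
  ... | yes p≡q = p≡q
  ... | no p≢q  = ⊥-elim (no-three r∈ p∈ q∈ (trans (cong (vtx G) r⁺) (plus-at x)) px qx
                   (λ { refl → p≢ r⁺ }) (λ { refl → q≢ r⁺ }) p≢q)

  minus-exists : (∀ h → h ∈ endpoints (allPassages (circuits S))) →
    {x : Fin (nV G)} {r : Passage G} → IsPlus S x r → ∃ λ q → IsMinus S x q
  minus-exists covers {x} {(h₁ , h₂)} (r∈ , r⁺) with Degree.third {G} FR {x} h₁ h₂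
  ... | k , kx , k≢h₁ , k≢h₂ with endpoints-∈ _ (covers k)
  ...   | q , q∈ , inj₁ refl = q , q∈ , kx , λ e → k≢h₁ (trans e (sym r⁺))
  ...   | q , q∈ , inj₂ refl = q , q∈ , trans (local q∈) kx ,
            λ e → k≢h₂ (cong proj₂ (entry-injective q∈ r∈ (trans e (sym r⁺))))

module _ {A : Set} where

  words : ℕ → List A → List (List A)
  words zero    S = [] ∷ []
  words (suc k) S = concatMap (λ a → map (a ∷_) (words k S)) S

  ∈-words : (S m : List A) → All (_∈ S) m → m ∈ words (length m) S
  ∈-words S []      []           = here refl
  ∈-words S (a ∷ m) (a∈S ∷ m⊆S) = ∈-concatMap-intro (λ a → map (a ∷_) (words (length m) S)) a∈S (∈-map⁺ (a ∷_) (∈-words S m m⊆S))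

  Blocks : Set
  Blocks = List A × List A × List A × List A

  splits : List A → List (List A × List A)
  splits []       = ([] , []) ∷ []
  splits (x ∷ xs) = ([] , x ∷ xs) ∷ map (λ r → (x ∷ proj₁ r , proj₂ r)) (splits xs)

  ∈-splits : (u v : List A) → (u , v) ∈ splits (u ++ v)
  ∈-splits []      []      = here refl
  ∈-splits []      (x ∷ v) = here refl
  ∈-splits (x ∷ u) v       = there (∈-map⁺ (λ r → (x ∷ proj₁ r , proj₂ r)) (∈-splits u v))

  splits4 : List A → List Blocks
  splits4 m =
    concatMap (λ r₁ →
      concatMap (λ r₂ → map (λ r₃ → proj₁ r₁ , proj₁ r₂ , proj₁ r₃ , proj₂ r₃) (splits (proj₂ r₂)))
                (splits (proj₂ r₁)))
    (splits m)

  ∈-splits4 : (m₁ m₂ m₃ m₄ : List A) → (m₁ , m₂ , m₃ , m₄) ∈ splits4 (m₁ ++ m₂ ++ m₃ ++ m₄)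
  ∈-splits4 m₁ m₂ m₃ m₄ =
    ∈-concatMap-intro _ (∈-splits m₁ (m₂ ++ m₃ ++ m₄))
      (∈-concatMap-intro _ (∈-splits m₂ (m₃ ++ m₄)) (∈-map⁺ (λ r₃ → m₁ , m₂ , proj₁ r₃ , proj₂ r₃) (∈-splits m₃ m₄)))

every : {B : Set} → (B → Bool) → List B → Bool
every p []       = true
every p (x ∷ xs) = p x ∧ every p xs

every-sound : {B : Set} {p : B → Bool} (xs : List B) → T (every p xs) → {x : B} → x ∈ xs → T (p x)
every-sound {p = p} (y ∷ xs) t m with p y in py
every-sound (y ∷ xs) t (here refl) | true = subst T (sym py) tt
every-sound (y ∷ xs) t (there m)   | true = every-sound xs t m

every-complete : {B : Set} {p : B → Bool} (xs : List B) → (∀ {x} → x ∈ xs → T (p x)) → T (every p xs)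
every-complete {p = p} []       _ = tt
every-complete {p = p} (y ∷ xs) h with p y in py
... | true  = every-complete xs (λ m → h (there m))
... | false = subst T py (h (here refl))

module Arrangements {A : Set} (_≟_ : DecidableEquality A) where
  open Data.List.Membership.DecPropositional _≟_ using (_∈?_)

  checkArrangements : (S : List A) {P : Blocks → Set} → ((b : Blocks) → Dec (P b)) → Bool
  checkArrangements S P? =
    every (λ m → not (every (λ s → isYes (s ∈? m)) S) ∨ every (λ b → isYes (P? b)) (splits4 m)) (words (length S) S)

  arrangement : (S : List A) → Unique S → {P : Blocks → Set} (P? : (b : Blocks) → Dec (P b)) →
    checkArrangements S P? ≡ true →
    (m₁ m₂ m₃ m₄ : List A) → Unique (m₁ ++ m₂ ++ m₃ ++ m₄) →
    (∀ {s} → s ∈ m₁ ++ m₂ ++ m₃ ++ m₄ → s ∈ S) → (∀ {s} → s ∈ S → s ∈ m₁ ++ m₂ ++ m₃ ++ m₄) →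
    P (m₁ , m₂ , m₃ , m₄)
  arrangement S S-unique P? verified m₁ m₂ m₃ m₄ m-unique m⊆S S⊆m =
    toWitness (every-sound (splits4 m) (implies (every-sound _ (subst T (sym verified) tt) m∈words) all-letters) (∈-splits4 m₁ m₂ m₃ m₄))
    where
    m : List A
    m = m₁ ++ m₂ ++ m₃ ++ m₄
    same-length : length m ≡ length S
    same-length = ≤-antisym (unique-length-≤ S m-unique m⊆S) (unique-length-≤ m S-unique S⊆m)
    m∈words : m ∈ words (length S) S
    m∈words = subst (λ k → m ∈ words k S) same-length (∈-words S m (tabulate m⊆S))
    all-letters : T (every (λ s → isYes (s ∈? m)) S)
    all-letters = every-complete S (λ {s} s∈S → fromWitness {a? = s ∈? m} (S⊆m s∈S))
    implies : {a b : Bool} → T (not a ∨ b) → T a → T b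
    implies {true} t _ = t

-- Letters naming the passages v⁺, v⁻, w⁺, w⁻ and those of two further vertices x, y.
data Letter : Set where
  V⁺ V⁻ W⁺ W⁻ X⁺ X⁻ Y⁺ Y⁻ : Letter

private
  index : Letter → ℕ
  index V⁺ = 0
  index V⁻ = 1
  index W⁺ = 2
  index W⁻ = 3
  index X⁺ = 4
  index X⁻ = 5
  index Y⁺ = 6
  index Y⁻ = 7

  index-injective : {a b : Letter} → index a ≡ index b → a ≡ b
  index-injective {V⁺} {V⁺} refl = refl
  index-injective {V⁻} {V⁻} refl = refl
  index-injective {W⁺} {W⁺} refl = refl
  index-injective {W⁻} {W⁻} refl = refl
  index-injective {X⁺} {X⁺} refl = refl
  index-injective {X⁻} {X⁻} refl = refl
  index-injective {Y⁺} {Y⁺} refl = refl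
  index-injective {Y⁻} {Y⁻} refl = refl

_≟ℓ_ : DecidableEquality Letter
a ≟ℓ b = map′ index-injective (cong index) (index a ≟ℕ index b)

open CyclicOrderDecision _≟ℓ_ public

-- The circuit v⁺T₁w⁺T₂v⁻T₃w⁻T₄ as a cyclic word (passage v⁺ is the one from T₄ to T₁), the
-- trails T₁ … T₄ contributing the words m₁ … m₄; and the circuit v⁺T₃w⁻T₂v⁻T₁w⁺T₄ of C ∗ (vw).
before after : List Letter → List Letter → List Letter → List Letter → List Letter
before m₁ m₂ m₃ m₄ = m₁ ++ W⁺ ∷ m₂ ++ V⁻ ∷ m₃ ++ W⁻ ∷ m₄ ++ V⁺ ∷ []
after  m₁ m₂ m₃ m₄ = m₃ ++ W⁻ ∷ m₂ ++ V⁻ ∷ m₁ ++ W⁺ ∷ m₄ ++ V⁺ ∷ []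

OneVertexRule : Blocks → Set
OneVertexRule (m₁ , m₂ , m₃ , m₄) =
  (interlace W′ X⁺ X⁻ V⁺ V⁻ ≡ interlace W X⁺ X⁻ W⁺ W⁻) × (interlace W′ X⁺ X⁻ W⁺ W⁻ ≡ - interlace W X⁺ X⁻ V⁺ V⁻) ×
  (interlace W′ V⁺ V⁻ X⁺ X⁻ ≡ interlace W W⁺ W⁻ X⁺ X⁻) × (interlace W′ W⁺ W⁻ X⁺ X⁻ ≡ - interlace W V⁺ V⁻ X⁺ X⁻) ×
  (interlace W X⁺ X⁻ W⁺ W⁻ * interlace W V⁺ V⁻ X⁺ X⁻ ≡ interlace W X⁺ X⁻ V⁺ V⁻ * interlace W W⁺ W⁻ X⁺ X⁻)
  where
  W W′ : List Letter
  W  = before m₁ m₂ m₃ m₄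
  W′ = after  m₁ m₂ m₃ m₄

TwoVertexRule : Blocks → Set
TwoVertexRule (m₁ , m₂ , m₃ , m₄) =
  interlace W′ X⁺ X⁻ Y⁺ Y⁻ ≡
    interlace W X⁺ X⁻ Y⁺ Y⁻ + interlace W X⁺ X⁻ W⁺ W⁻ * interlace W V⁺ V⁻ Y⁺ Y⁻
      - interlace W X⁺ X⁻ V⁺ V⁻ * interlace W W⁺ W⁻ Y⁺ Y⁻
  where
  W W′ : List Letter
  W  = before m₁ m₂ m₃ m₄
  W′ = after  m₁ m₂ m₃ m₄

private
  open Arrangements _≟ℓ_

  oneVertexRule? : (b : Blocks) → Dec (OneVertexRule b)
  oneVertexRule? (m₁ , m₂ , m₃ , m₄) = (_ ≟ℤ _) ×-dec (_ ≟ℤ _) ×-dec (_ ≟ℤ _) ×-dec (_ ≟ℤ _) ×-dec (_ ≟ℤ _)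

  twoVertexRule? : (b : Blocks) → Dec (TwoVertexRule b)
  twoVertexRule? (m₁ , m₂ , m₃ , m₄) = _ ≟ℤ _

  X : List Letter
  X = X⁺ ∷ X⁻ ∷ []

  XY : List Letter
  XY = X⁺ ∷ X⁻ ∷ Y⁺ ∷ Y⁻ ∷ []

-- Both rules hold whenever the trails carry exactly the passages of x (and of y), by
-- exhaustive verification over all arrangements.
oneVertexRule : (m₁ m₂ m₃ m₄ : List Letter) → Unique (m₁ ++ m₂ ++ m₃ ++ m₄) →
  (∀ {s} → s ∈ m₁ ++ m₂ ++ m₃ ++ m₄ → s ∈ X) → (∀ {s} → s ∈ X → s ∈ m₁ ++ m₂ ++ m₃ ++ m₄) →
  OneVertexRule (m₁ , m₂ , m₃ , m₄)
oneVertexRule = arrangement X ((( λ ()) ∷ []) ∷ [] ∷ []) oneVertexRule? refl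

twoVertexRule : (m₁ m₂ m₃ m₄ : List Letter) → Unique (m₁ ++ m₂ ++ m₃ ++ m₄) →
  (∀ {s} → s ∈ m₁ ++ m₂ ++ m₃ ++ m₄ → s ∈ XY) → (∀ {s} → s ∈ XY → s ∈ m₁ ++ m₂ ++ m₃ ++ m₄) →
  TwoVertexRule (m₁ , m₂ , m₃ , m₄)
twoVertexRule = arrangement XY distinct twoVertexRule? refl
  where
  distinct : Unique XY
  distinct = ((λ ()) ∷ (λ ()) ∷ (λ ()) ∷ []) ∷ ((λ ()) ∷ (λ ()) ∷ []) ∷ ((λ ()) ∷ []) ∷ [] ∷ []

does-true : {P : Set} (d : Dec P) → does d ≡ true → P
does-true (yes p) _ = p

does-false : {P : Set} (d : Dec P) → does d ≡ false → ¬ P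
does-false (no ¬p) _ = ¬p

interlacement-sign : {G : Graph} {S : SignedSys G} {I : Matrix (nV G)} → IsInterlacement S I →
  {a b : Fin (nV G)} → a ≢ b → {P Q : Set} → (OrderPos S a b → P) → (P → OrderPos S a b) →
  (OrderNeg S a b → Q) → (Q → OrderNeg S a b) → (d₁ : Dec P) (d₂ : Dec Q) → I a b ≡ sign d₁ d₂
interlacement-sign isI {a} {b} a≢b _  to-pos _  _      (yes p) _       = proj₁ (proj₂ (isI a b) a≢b) (to-pos p)
interlacement-sign isI {a} {b} a≢b _  _      _  to-neg (no _)  (yes q) = proj₁ (proj₂ (proj₂ (isI a b) a≢b)) (to-neg q)
interlacement-sign isI {a} {b} a≢b fr _      fr′ _     (no ¬p) (no ¬q) =
  proj₂ (proj₂ (proj₂ (isI a b) a≢b)) (λ o → ¬p (fr o)) (λ o → ¬q (fr′ o))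

-- Labelling the passages at four vertices v, w, x, y by letters: a passage at the first of
-- v, w, x, y that is its vertex gets that vertex's letter, with sign + iff it enters through
-- the designated half-edge  pl  of the vertex.  Passages elsewhere stay unlabelled.
module Labelling {G : Graph} (pl : Fin (nV G) → HalfEdge G) (v w x y : Fin (nV G)) where

  signed : Bool → Letter → Letter → Letter
  signed true  p m = p
  signed false p m = m

  choose : {z : Fin (nV G)} → Dec (z ≡ v) → Dec (z ≡ w) → Dec (z ≡ x) → Dec (z ≡ y) → Bool → Maybe Letter
  choose (yes _) _       _       _       b = just (signed b V⁺ V⁻)
  choose (no _)  (yes _) _       _       b = just (signed b W⁺ W⁻)
  choose (no _)  (no _)  (yes _) _       b = just (signed b X⁺ X⁻)
  choose (no _)  (no _)  (no _)  (yes _) b = just (signed b Y⁺ Y⁻)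
  choose (no _)  (no _)  (no _)  (no _)  b = nothing

  isEntry : HalfEdge G → Bool
  isEntry h = does (h ≟ʰ pl (vtx G h))

  labelHE : HalfEdge G → Maybe Letter
  labelHE h = choose (vtx G h ≟ᶠ v) (vtx G h ≟ᶠ w) (vtx G h ≟ᶠ x) (vtx G h ≟ᶠ y) (isEntry h)

  label : Passage G → Maybe Letter
  label p = labelHE (proj₁ p)

  named : Letter → Fin (nV G)
  named V⁺ = v
  named V⁻ = v
  named W⁺ = w
  named W⁻ = w
  named X⁺ = x
  named X⁻ = x
  named Y⁺ = y
  named Y⁻ = y

  positive : Letter → Bool
  positive V⁺ = true
  positive W⁺ = true
  positive X⁺ = true
  positive Y⁺ = true
  positive _  = false

  Earlier : Letter → Fin (nV G) → Set
  Earlier V⁺ z = ⊤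
  Earlier V⁻ z = ⊤
  Earlier W⁺ z = z ≢ v
  Earlier W⁻ z = z ≢ v
  Earlier X⁺ z = (z ≢ v) × (z ≢ w)
  Earlier X⁻ z = (z ≢ v) × (z ≢ w)
  Earlier Y⁺ z = (z ≢ v) × (z ≢ w) × (z ≢ x)
  Earlier Y⁻ z = (z ≢ v) × (z ≢ w) × (z ≢ x)

  private
    choose-inv : {z : Fin (nV G)} {s : Letter} (d₁ : Dec (z ≡ v)) (d₂ : Dec (z ≡ w)) (d₃ : Dec (z ≡ x)) (d₄ : Dec (z ≡ y))
      (b : Bool) → choose d₁ d₂ d₃ d₄ b ≡ just s → (z ≡ named s) × (b ≡ positive s) × Earlier s z
    choose-inv (yes q) _        _        _       true  refl = q , refl , tt
    choose-inv (yes q) _        _        _       false refl = q , refl , tt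
    choose-inv (no n₁) (yes q)  _        _       true  refl = q , refl , n₁
    choose-inv (no n₁) (yes q)  _        _       false refl = q , refl , n₁
    choose-inv (no n₁) (no n₂)  (yes q)  _       true  refl = q , refl , n₁ , n₂
    choose-inv (no n₁) (no n₂)  (yes q)  _       false refl = q , refl , n₁ , n₂
    choose-inv (no n₁) (no n₂)  (no n₃)  (yes q) true  refl = q , refl , n₁ , n₂ , n₃
    choose-inv (no n₁) (no n₂)  (no n₃)  (yes q) false refl = q , refl , n₁ , n₂ , n₃
    choose-inv (no _)  (no _)   (no _)   (no _)  b     ()

  read : (h : HalfEdge G) {s : Letter} → labelHE h ≡ just s → (vtx G h ≡ named s) × (isEntry h ≡ positive s) × Earlier s (vtx G h)
  read h = choose-inv (vtx G h ≟ᶠ v) (vtx G h ≟ᶠ w) (vtx G h ≟ᶠ x) (vtx G h ≟ᶠ y) (isEntry h)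

  private
    at-v : {z : Fin (nV G)} (d₁ : Dec (z ≡ v)) (d₂ : Dec (z ≡ w)) (d₃ : Dec (z ≡ x)) (d₄ : Dec (z ≡ y)) (b : Bool) →
      z ≡ v → choose d₁ d₂ d₃ d₄ b ≡ just (signed b V⁺ V⁻)
    at-v (yes _) _ _ _ b _ = refl
    at-v (no n)  _ _ _ b q = ⊥-elim (n q)

    at-w : {z : Fin (nV G)} (d₁ : Dec (z ≡ v)) (d₂ : Dec (z ≡ w)) (d₃ : Dec (z ≡ x)) (d₄ : Dec (z ≡ y)) (b : Bool) →
      w ≢ v → z ≡ w → choose d₁ d₂ d₃ d₄ b ≡ just (signed b W⁺ W⁻)
    at-w (yes e) _       _ _ b n₁ q = ⊥-elim (n₁ (trans (sym q) e))
    at-w (no _)  (yes _) _ _ b _  _ = refl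
    at-w (no _)  (no n)  _ _ b _  q = ⊥-elim (n q)

    at-x : {z : Fin (nV G)} (d₁ : Dec (z ≡ v)) (d₂ : Dec (z ≡ w)) (d₃ : Dec (z ≡ x)) (d₄ : Dec (z ≡ y)) (b : Bool) →
      x ≢ v → x ≢ w → z ≡ x → choose d₁ d₂ d₃ d₄ b ≡ just (signed b X⁺ X⁻)
    at-x (yes e) _       _       _ b n₁ _  q = ⊥-elim (n₁ (trans (sym q) e))
    at-x (no _)  (yes e) _       _ b _  n₂ q = ⊥-elim (n₂ (trans (sym q) e))
    at-x (no _)  (no _)  (yes _) _ b _  _  _ = refl
    at-x (no _)  (no _)  (no n)  _ b _  _  q = ⊥-elim (n q)

    at-y : {z : Fin (nV G)} (d₁ : Dec (z ≡ v)) (d₂ : Dec (z ≡ w)) (d₃ : Dec (z ≡ x)) (d₄ : Dec (z ≡ y)) (b : Bool) →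
      y ≢ v → y ≢ w → y ≢ x → z ≡ y → choose d₁ d₂ d₃ d₄ b ≡ just (signed b Y⁺ Y⁻)
    at-y (yes e) _       _       _       b n₁ _  _  q = ⊥-elim (n₁ (trans (sym q) e))
    at-y (no _)  (yes e) _       _       b _  n₂ _  q = ⊥-elim (n₂ (trans (sym q) e))
    at-y (no _)  (no _)  (yes e) _       b _  _  n₃ q = ⊥-elim (n₃ (trans (sym q) e))
    at-y (no _)  (no _)  (no _)  (yes _) b _  _  _  _ = refl
    at-y (no _)  (no _)  (no _)  (no n)  b _  _  _  q = ⊥-elim (n q)

  module _ (S : SignedSys G) where

    record Names (R : Passage G → Set) (ℓ : Letter) : Set where
      field
        names      : ∀ {e} → R e → label e ≡ just ℓ
        named-only : ∀ {e} → e ∈ allPassages (circuits S) → label e ≡ just ℓ → R e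

    Tracks : Fin (nV G) → Letter → Letter → Set
    Tracks r ℓ⁺ ℓ⁻ = Names (IsPlus S r) ℓ⁺ × Names (IsMinus S r) ℓ⁻

    module _ (pl≡ : plus S ≡ pl) (plus-at : ∀ z → vtx G (pl z) ≡ z) where

      private
        tracks : (r : Fin (nV G)) (ℓ⁺ ℓ⁻ : Letter) → named ℓ⁺ ≡ r → named ℓ⁻ ≡ r →
          positive ℓ⁺ ≡ true → positive ℓ⁻ ≡ false → (∀ h → vtx G h ≡ r → labelHE h ≡ just (signed (isEntry h) ℓ⁺ ℓ⁻)) → Tracks r ℓ⁺ ℓ⁻
        tracks r ℓ⁺ ℓ⁻ n⁺ n⁻ p⁺ p⁻ lab-r =
          record { names = λ { {e} (_ , q) → plus-names e q } ; named-only = λ e∈ l → plus-only e∈ l } ,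
          record { names = λ { {e} (_ , er , q) → minus-names e er q } ; named-only = λ e∈ l → minus-only e∈ l }
          where
          plus-names : (e : Passage G) → proj₁ e ≡ plus S r → label e ≡ just ℓ⁺
          plus-names e q rewrite pl≡ = trans (lab-r (proj₁ e) (trans (cong (vtx G) q) (plus-at r)))
            (cong (λ b → just (signed b ℓ⁺ ℓ⁻)) (dec-true (proj₁ e ≟ʰ _) (trans q (cong pl (sym (trans (cong (vtx G) q) (plus-at r)))))))
          minus-names : (e : Passage G) → vtx G (proj₁ e) ≡ r → proj₁ e ≢ plus S r → label e ≡ just ℓ⁻
          minus-names e er q rewrite pl≡ = trans (lab-r (proj₁ e) er)
            (cong (λ b → just (signed b ℓ⁺ ℓ⁻)) (dec-false (proj₁ e ≟ʰ _) (λ eq → q (trans eq (cong pl er)))))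
          plus-only : {e : Passage G} → e ∈ allPassages (circuits S) → label e ≡ just ℓ⁺ → IsPlus S r e
          plus-only {e} e∈ l with read (proj₁ e) l
          ... | er , sg , _ = e∈ , trans (does-true (proj₁ e ≟ʰ _) (trans sg p⁺))
                                          (trans (cong pl (trans er n⁺)) (sym (cong (λ f → f r) pl≡)))
          minus-only : {e : Passage G} → e ∈ allPassages (circuits S) → label e ≡ just ℓ⁻ → IsMinus S r e
          minus-only {e} e∈ l with read (proj₁ e) l
          ... | er , sg , _ = e∈ , trans er n⁻ ,
            λ q → does-false (proj₁ e ≟ʰ _) (trans sg p⁻) (trans q (trans (cong (λ f → f r) pl≡) (cong pl (sym (trans er n⁻)))))

      tracks-v : Tracks v V⁺ V⁻
      tracks-v = tracks v V⁺ V⁻ refl refl refl refl (λ h q → at-v _ _ _ _ _ q)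

      tracks-w : w ≢ v → Tracks w W⁺ W⁻
      tracks-w n = tracks w W⁺ W⁻ refl refl refl refl (λ h q → at-w _ _ _ _ _ n q)

      tracks-x : x ≢ v → x ≢ w → Tracks x X⁺ X⁻
      tracks-x n₁ n₂ = tracks x X⁺ X⁻ refl refl refl refl (λ h q → at-x _ _ _ _ _ n₁ n₂ q)

      tracks-y : y ≢ v → y ≢ w → y ≢ x → Tracks y Y⁺ Y⁻
      tracks-y n₁ n₂ n₃ = tracks y Y⁺ Y⁻ refl refl refl refl (λ h q → at-y _ _ _ _ _ n₁ n₂ n₃ q)

module LabelledInterlacement {G : Graph} (pl : Fin (nV G) → HalfEdge G) (v w x y : Fin (nV G))
    (S : SignedSys G) (unique-ends : Unique (endpoints (allPassages (circuits S)))) where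
  open Labelling pl v w x y
  open Endpoints unique-ends

  word : List (Dart G) → List Letter
  word c = mapMaybe label (passages c)

  CircuitOrder : (R₁ R₂ R₃ R₄ : Passage G → Set) → Set
  CircuitOrder R₁ R₂ R₃ R₄ = Σ (List (Dart G)) λ c → (c ∈ circuits S) ×
    ∃[ p₁ ] ∃[ p₂ ] ∃[ p₃ ] ∃[ p₄ ] (R₁ p₁ × R₂ p₂ × R₃ p₃ × R₄ p₄ × CyclicOrder (passages c) p₁ p₂ p₃ p₄)

  same-circuit : {c₁ c₂ : List (Dart G)} {e : Passage G} → c₁ ∈ circuits S → c₂ ∈ circuits S →
    e ∈ passages c₁ → e ∈ passages c₂ → c₁ ≡ c₂
  same-circuit = unique-concatMap-block passages (circuits S) unique-pairs

  module _ {R₁ R₂ R₃ R₄ : Passage G → Set} {ℓ₁ ℓ₂ ℓ₃ ℓ₄ : Letter}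
           (N₁ : Names S R₁ ℓ₁) (N₂ : Names S R₂ ℓ₂) (N₃ : Names S R₃ ℓ₃) (N₄ : Names S R₄ ℓ₄)
           {c₀ : List (Dart G)} (c₀∈ : c₀ ∈ circuits S) {e : Passage G} (e∈ : e ∈ passages c₀)
           (R₁-unique : ∀ {p} → R₁ p → p ≡ e) where
    open Names

    circuitOrder→word : CircuitOrder R₁ R₂ R₃ R₄ → CyclicOrder (word c₀) ℓ₁ ℓ₂ ℓ₃ ℓ₄
    circuitOrder→word (c , c∈ , p₁ , p₂ , p₃ , p₄ , r₁ , r₂ , r₃ , r₄ , o) with R₁-unique r₁
    ... | refl with same-circuit c∈ c₀∈ (proj₁ (cyclicOrder-∈ o)) e∈
    ... | refl = cyclicOrder-relabel label (names N₁ r₁) (names N₂ r₂) (names N₃ r₃) (names N₄ r₄) o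

    word→circuitOrder : CyclicOrder (word c₀) ℓ₁ ℓ₂ ℓ₃ ℓ₄ → CircuitOrder R₁ R₂ R₃ R₄
    word→circuitOrder o with cyclicOrder-unrelabel label o
    ... | p₁ , p₂ , p₃ , p₄ , l₁ , l₂ , l₃ , l₄ , o′ =
      let m₁ , m₂ , m₃ , m₄ = cyclicOrder-∈ o′ in
      c₀ , c₀∈ , p₁ , p₂ , p₃ , p₄ ,
      named-only N₁ (on m₁) l₁ , named-only N₂ (on m₂) l₂ , named-only N₃ (on m₃) l₃ , named-only N₄ (on m₄) l₄ , o′
      where
      on : {p : Passage G} → p ∈ passages c₀ → p ∈ allPassages (circuits S)
      on = ∈-concatMap-intro passages c₀∈

  interlacement-word : {I : Matrix (nV G)} → IsInterlacement S I →
    (a b : Fin (nV G)) {a⁺ a⁻ b⁺ b⁻ : Letter} → a ≢ b → Tracks S a a⁺ a⁻ → Tracks S b b⁺ b⁻ →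
    {c₀ : List (Dart G)} → c₀ ∈ circuits S → {e : Passage G} → IsPlus S a e → e ∈ passages c₀ →
    I a b ≡ interlace (word c₀) a⁺ a⁻ b⁺ b⁻
  interlacement-word isI a b a≢b (A⁺ , A⁻) (B⁺ , B⁻) c₀∈ {e} e⁺ e∈ =
    interlacement-sign isI a≢b
      (circuitOrder→word A⁺ B⁻ A⁻ B⁺ c₀∈ e∈ only-e) (word→circuitOrder A⁺ B⁻ A⁻ B⁺ c₀∈ e∈ only-e)
      (circuitOrder→word A⁺ B⁺ A⁻ B⁻ c₀∈ e∈ only-e) (word→circuitOrder A⁺ B⁺ A⁻ B⁻ c₀∈ e∈ only-e)
      _ _
    where
    only-e : ∀ {p} → IsPlus S a p → p ≡ e
    only-e p = plus-unique {S = S} unique-ends p e⁺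

δ-refl : {n : ℕ} (x : Fin n) → δ x x ≡ + 1
δ-refl x with x ≟ᶠ x
... | yes _ = refl
... | no x≢x = ⊥-elim (x≢x refl)

δ-≢ : {n : ℕ} {x y : Fin n} → x ≢ y → δ x y ≡ + 0
δ-≢ {x = x} {y} x≢y with x ≟ᶠ y
... | yes x≡y = ⊥-elim (x≢y x≡y)
... | no _    = refl

record InterlacementChange {n : ℕ} (v w : Fin n) (I I′ : Matrix n) : Set where
  field
    diag     : ∀ x → I x x ≡ + 0
    diag′    : ∀ x → I′ x x ≡ + 0
    I-wv     : I w v ≡ + 1
    I-vw     : I v w ≡ -[1+ 0 ]
    I′-wv    : I′ w v ≡ -[1+ 0 ]
    I′-vw    : I′ v w ≡ + 1
    column-v : ∀ x → x ≢ v → x ≢ w → I′ x v ≡ I x w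
    column-w : ∀ x → x ≢ v → x ≢ w → I′ x w ≡ - I x v
    row-v    : ∀ x → x ≢ v → x ≢ w → I′ v x ≡ I w x
    row-w    : ∀ x → x ≢ v → x ≢ w → I′ w x ≡ - I v x
    balance  : ∀ x → x ≢ v → x ≢ w → I x w * I v x ≡ I x v * I w x
    other    : ∀ x y → x ≢ v → x ≢ w → y ≢ v → y ≢ w → y ≢ x → I′ x y ≡ I x y + I x w * I v y - I x v * I w y

record TransitionChange {n : ℕ} (v w : Fin n) (Phi Chi Phi′ Chi′ : Fin n → Set) : Set where
  field
    φ-or-χ : ∀ c → Phi c ⊎ Chi c
    φ-v    : Phi v → Chi′ v
    χ-v    : Chi v → Phi′ v
    φ-w    : Phi w → Chi′ w
    χ-w    : Chi w → Phi′ w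
    φ-keep : ∀ {c} → c ≢ v → c ≢ w → Phi c → Phi′ c
    χ-keep : ∀ {c} → c ≢ v → c ≢ w → Chi c → Chi′ c

M0Spec : {n : ℕ} → (Fin n → Set) → (Fin n → Set) → Matrix n → Matrix n → Set
M0Spec Phi Chi I M = ∀ x c → (Phi c → M x c ≡ δ x c) × (Chi c → M x c ≡ I x c)

module RowIdentities {n : ℕ} {v w : Fin n} {I I′ M M′ : Matrix n} {Phi Chi Phi′ Chi′ : Fin n → Set}
  (Δ : InterlacementChange v w I I′) (τ : TransitionChange v w Phi Chi Phi′ Chi′)
  (M-spec : M0Spec Phi Chi I M) (M′-spec : M0Spec Phi′ Chi′ I′ M′) where
  open InterlacementChange Δ
  open TransitionChange τ

  private
    φ-entry : ∀ {x c} → Phi c → M x c ≡ δ x c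
    φ-entry = proj₁ (M-spec _ _)
    χ-entry : ∀ {x c} → Chi c → M x c ≡ I x c
    χ-entry = proj₂ (M-spec _ _)
    φ′-entry : ∀ {x c} → Phi′ c → M′ x c ≡ δ x c
    φ′-entry = proj₁ (M′-spec _ _)
    χ′-entry : ∀ {x c} → Chi′ c → M′ x c ≡ I′ x c
    χ′-entry = proj₂ (M′-spec _ _)

    w≢v : w ≢ v
    w≢v refl with trans (sym I-wv) (diag w)
    ... | ()

    v≢w : v ≢ w
    v≢w e = w≢v (sym e)

    sym≢ : {a b : Fin n} → a ≢ b → b ≢ a
    sym≢ a≢b e = a≢b (sym e)

  v-row : ∀ c → M′ v c ≡ M w c
  v-row c with c ≟ᶠ v | c ≟ᶠ w | φ-or-χ c
  ... | yes refl | _        | inj₁ φ = trans (χ′-entry (φ-v φ)) (trans (diag′ c) (sym (trans (φ-entry φ) (δ-≢ w≢v))))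
  ... | yes refl | _        | inj₂ χ = trans (φ′-entry (χ-v χ)) (trans (δ-refl c) (sym (trans (χ-entry χ) I-wv)))
  ... | no _     | yes refl | inj₁ φ = trans (χ′-entry (φ-w φ)) (trans I′-vw (sym (trans (φ-entry φ) (δ-refl c))))
  ... | no _     | yes refl | inj₂ χ = trans (φ′-entry (χ-w χ)) (trans (δ-≢ v≢w) (sym (trans (χ-entry χ) (diag c))))
  ... | no c≢v   | no c≢w   | inj₁ φ =
    trans (φ′-entry (φ-keep c≢v c≢w φ)) (trans (δ-≢ (sym≢ c≢v)) (sym (trans (φ-entry φ) (δ-≢ (sym≢ c≢w)))))
  ... | no c≢v   | no c≢w   | inj₂ χ = trans (χ′-entry (χ-keep c≢v c≢w χ)) (trans (row-v c c≢v c≢w) (sym (χ-entry χ)))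

  w-row : ∀ c → M′ w c ≡ - M v c
  w-row c with c ≟ᶠ v | c ≟ᶠ w | φ-or-χ c
  ... | yes refl | _        | inj₁ φ = trans (χ′-entry (φ-v φ)) (trans I′-wv (cong -_ (sym (trans (φ-entry φ) (δ-refl c)))))
  ... | yes refl | _        | inj₂ χ = trans (φ′-entry (χ-v χ)) (trans (δ-≢ w≢v) (cong -_ (sym (trans (χ-entry χ) (diag c)))))
  ... | no _     | yes refl | inj₁ φ = trans (χ′-entry (φ-w φ)) (trans (diag′ c) (cong -_ (sym (trans (φ-entry φ) (δ-≢ v≢w)))))
  ... | no _     | yes refl | inj₂ χ = trans (φ′-entry (χ-w χ)) (trans (δ-refl c) (cong -_ (sym (trans (χ-entry χ) I-vw))))
  ... | no c≢v   | no c≢w   | inj₁ φ =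
    trans (φ′-entry (φ-keep c≢v c≢w φ)) (trans (δ-≢ (sym≢ c≢w)) (cong -_ (sym (trans (φ-entry φ) (δ-≢ (sym≢ c≢v))))))
  ... | no c≢v   | no c≢w   | inj₂ χ = trans (χ′-entry (χ-keep c≢v c≢w χ)) (trans (row-w c c≢v c≢w) (cong -_ (sym (χ-entry χ))))

  private
    id-φ-v : ∀ a b → a ≡ + 0 + a * + 1 - b * + 0
    id-φ-v = solve-∀
    id-χ-v : ∀ a b → + 0 ≡ a + b * + 0 - a * + 1
    id-χ-v = solve-∀
    id-φ-w : ∀ a b → - a ≡ + 0 + b * + 0 - a * + 1
    id-φ-w = solve-∀
    id-χ-w : ∀ a b → + 0 ≡ a + a * -[1+ 0 ] - b * + 0
    id-χ-w = solve-∀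
    id-φ : ∀ a b c → a ≡ a + b * + 0 - c * + 0
    id-φ = solve-∀
    id-cancel : ∀ a b → + 0 ≡ + 0 + a * b - a * b
    id-cancel = solve-∀

  other-rows : ∀ x → x ≢ v → x ≢ w → ∀ c → M′ x c ≡ M x c + I x w * M v c - I x v * M w c
  other-rows x x≢v x≢w c with c ≟ᶠ v | c ≟ᶠ w | φ-or-χ c
  ... | yes refl | _ | inj₁ φ
    rewrite χ′-entry {x} (φ-v φ) | φ-entry {x} φ | φ-entry {c} φ | φ-entry {w} φ
          | δ-≢ x≢v | δ-refl c | δ-≢ w≢v | column-v x x≢v x≢w = id-φ-v (I x w) (I x c)
  ... | yes refl | _ | inj₂ χ
    rewrite φ′-entry {x} (χ-v χ) | χ-entry {x} χ | χ-entry {c} χ | χ-entry {w} χ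
          | δ-≢ x≢v | diag c | I-wv = id-χ-v (I x c) (I x w)
  ... | no _ | yes refl | inj₁ φ
    rewrite χ′-entry {x} (φ-w φ) | φ-entry {x} φ | φ-entry {v} φ | φ-entry {c} φ
          | δ-≢ x≢w | δ-≢ v≢w | δ-refl c | column-w x x≢v x≢w = id-φ-w (I x v) (I x c)
  ... | no _ | yes refl | inj₂ χ
    rewrite φ′-entry {x} (χ-w χ) | χ-entry {x} χ | χ-entry {v} χ | χ-entry {c} χ
          | δ-≢ x≢w | diag c | I-vw = id-χ-w (I x c) (I x v)
  ... | no c≢v | no c≢w | inj₁ φ
    rewrite φ′-entry {x} (φ-keep c≢v c≢w φ) | φ-entry {x} φ | φ-entry {v} φ | φ-entry {w} φ
          | δ-≢ (sym≢ c≢v) | δ-≢ (sym≢ c≢w) = id-φ (δ x c) (I x w) (I x v)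
  ... | no c≢v | no c≢w | inj₂ χ
    rewrite χ′-entry {x} (χ-keep c≢v c≢w χ) | χ-entry {x} χ | χ-entry {v} χ | χ-entry {w} χ with x ≟ᶠ c
  ...   | yes refl rewrite diag x | diag′ x | balance x x≢v x≢w = id-cancel (I x v) (I w x)
  ...   | no x≢c = other x c x≢v x≢w c≢v c≢w (sym≢ x≢c)

-- Passages of a circuit assembled from trails.  A trail is a nonempty dart list  ds ∷ʳ e;
-- first ds e is its first dart and  inside ds e  the passages between its consecutive darts.
module _ {G : Graph} where

  first : List (Dart G) → Dart G → Dart G
  first []      e = e
  first (d ∷ _) _ = d

  inside : List (Dart G) → Dart G → List (Passage G)
  inside []       e = []
  inside (d ∷ ds) e = (headHE d , tailHE (first ds e)) ∷ inside ds e

  into : Dart G → List (Dart G) → Dart G → Passage G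
  into d ds e = (headHE d , tailHE (first ds e))

  private
    walk′ : Dart G → List (Dart G) → Dart G → List (Passage G)
    walk′ d []        n = (headHE d , tailHE n) ∷ []
    walk′ d (d′ ∷ ds) n = (headHE d , tailHE d′) ∷ walk′ d′ ds n

    walk : List (Dart G) → Dart G → List (Passage G)
    walk []       n = []
    walk (d ∷ ds) n = walk′ d ds n

    passages-walk : (u : List (Dart G)) (z : Dart G) → passages u ≡ walk u (first u z)
    passages-walk []       z = refl
    passages-walk (d ∷ ds) z = go d ds d
      where
      go : (d : Dart G) (ds : List (Dart G)) (n : Dart G) →
        zipWith (λ a b → (headHE a , tailHE b)) (d ∷ ds) (ds ++ [ n ]) ≡ walk′ d ds n
      go d []        n = refl
      go d (d′ ∷ ds) n = cong (_ ∷_) (go d′ ds n)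

    walk-++ : (X Y : List (Dart G)) (n : Dart G) → walk (X ++ Y) n ≡ walk X (first Y n) ++ walk Y n
    walk-++ []       Y n = refl
    walk-++ (d ∷ ds) Y n = go d ds Y
      where
      go : (d : Dart G) (ds Y : List (Dart G)) → walk′ d (ds ++ Y) n ≡ walk′ d ds (first Y n) ++ walk Y n
      go d []        []      = refl
      go d []        (y ∷ Y) = refl
      go d (d′ ∷ ds) Y       = cong (_ ∷_) (go d′ ds Y)

    walk-trail : (ds : List (Dart G)) (e n : Dart G) → walk (ds ∷ʳ e) n ≡ inside ds e ++ (headHE e , tailHE n) ∷ []
    walk-trail []       e n = refl
    walk-trail (d ∷ ds) e n = go d ds
      where
      go : (d : Dart G) (ds : List (Dart G)) → walk′ d (ds ∷ʳ e) n ≡ (headHE d , tailHE (first ds e)) ∷ inside ds e ++ (headHE e , tailHE n) ∷ []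
      go d []        = refl
      go d (d′ ∷ ds) = cong (_ ∷_) (go d′ ds)

    first-trail : (ds : List (Dart G)) (e : Dart G) (Y : List (Dart G)) (z : Dart G) → first ((ds ∷ʳ e) ++ Y) z ≡ first ds e
    first-trail []      e Y z = refl
    first-trail (d ∷ _) e Y z = refl

    first-∷ʳ : (ds : List (Dart G)) (e z : Dart G) → first (ds ∷ʳ e) z ≡ first ds e
    first-∷ʳ []      e z = refl
    first-∷ʳ (d ∷ _) e z = refl

    walk-trail-++ : (ds : List (Dart G)) (e : Dart G) (Y : List (Dart G)) (n f : Dart G) → first Y n ≡ f →
      walk ((ds ∷ʳ e) ++ Y) n ≡ inside ds e ++ (headHE e , tailHE f) ∷ walk Y n
    walk-trail-++ ds e Y n f refl = begin
      walk ((ds ∷ʳ e) ++ Y) n                                          ≡⟨ walk-++ (ds ∷ʳ e) Y n ⟩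
      walk (ds ∷ʳ e) (first Y n) ++ walk Y n                           ≡⟨ cong (_++ walk Y n) (walk-trail ds e (first Y n)) ⟩
      (inside ds e ++ (headHE e , tailHE (first Y n)) ∷ []) ++ walk Y n ≡⟨ ++-assoc (inside ds e) _ (walk Y n) ⟩
      inside ds e ++ (headHE e , tailHE (first Y n)) ∷ walk Y n        ∎
      where open ≡-Reasoning

  passages-4 : (ds₁ ds₂ ds₃ ds₄ : List (Dart G)) (e₁ e₂ e₃ e₄ : Dart G) →
    passages ((ds₁ ∷ʳ e₁) ++ (ds₂ ∷ʳ e₂) ++ (ds₃ ∷ʳ e₃) ++ (ds₄ ∷ʳ e₄)) ≡
      blocks (inside ds₁ e₁) (inside ds₂ e₂) (inside ds₃ e₃) (inside ds₄ e₄)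
             (into e₁ ds₂ e₂) (into e₂ ds₃ e₃) (into e₃ ds₄ e₄) (into e₄ ds₁ e₁)
  passages-4 ds₁ ds₂ ds₃ ds₄ e₁ e₂ e₃ e₄ = begin
    passages (T₁ ++ T₂ ++ T₃ ++ T₄)                    ≡⟨ passages-walk (T₁ ++ T₂ ++ T₃ ++ T₄) e₁ ⟩
    walk (T₁ ++ T₂ ++ T₃ ++ T₄) (first (T₁ ++ T₂ ++ T₃ ++ T₄) e₁)
      ≡⟨ cong (walk (T₁ ++ T₂ ++ T₃ ++ T₄)) (first-trail ds₁ e₁ _ e₁) ⟩
    walk (T₁ ++ T₂ ++ T₃ ++ T₄) n                      ≡⟨ walk-trail-++ ds₁ e₁ _ n _ (first-trail ds₂ e₂ _ n) ⟩
    inside ds₁ e₁ ++ _ ∷ walk (T₂ ++ T₃ ++ T₄) n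
      ≡⟨ cong (λ z → inside ds₁ e₁ ++ _ ∷ z) (walk-trail-++ ds₂ e₂ _ n _ (first-trail ds₃ e₃ _ n)) ⟩
    inside ds₁ e₁ ++ _ ∷ inside ds₂ e₂ ++ _ ∷ walk (T₃ ++ T₄) n
      ≡⟨ cong (λ z → inside ds₁ e₁ ++ _ ∷ inside ds₂ e₂ ++ _ ∷ z) (walk-trail-++ ds₃ e₃ _ n _ (first-∷ʳ ds₄ e₄ n)) ⟩
    inside ds₁ e₁ ++ _ ∷ inside ds₂ e₂ ++ _ ∷ inside ds₃ e₃ ++ _ ∷ walk T₄ n
      ≡⟨ cong (λ z → inside ds₁ e₁ ++ _ ∷ inside ds₂ e₂ ++ _ ∷ inside ds₃ e₃ ++ _ ∷ z) (walk-trail ds₄ e₄ n) ⟩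
    blocks (inside ds₁ e₁) (inside ds₂ e₂) (inside ds₃ e₃) (inside ds₄ e₄) _ _ _ (into e₄ ds₁ e₁) ∎
    where
    open ≡-Reasoning
    T₁ T₂ T₃ T₄ : List (Dart G)
    T₁ = ds₁ ∷ʳ e₁
    T₂ = ds₂ ∷ʳ e₂
    T₃ = ds₃ ∷ʳ e₃
    T₄ = ds₄ ∷ʳ e₄
    n : Dart G
    n = first ds₁ e₁

  passages-rotate : (xs ys : List (Dart G)) →
    ∃₂ λ r₁ r₂ → (passages (xs ++ ys) ≡ r₁ ++ r₂) × (passages (ys ++ xs) ≡ r₂ ++ r₁)
  passages-rotate [] ys =
    [] , passages ys , refl , trans (cong passages (++-identityʳ ys)) (sym (++-identityʳ _))
  passages-rotate (x ∷ xs) [] =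
    passages (x ∷ xs) , [] , trans (cong passages (++-identityʳ (x ∷ xs))) (sym (++-identityʳ _)) , refl
  passages-rotate (x ∷ xs) (y ∷ ys) = walk (x ∷ xs) y , walk (y ∷ ys) x ,
    trans (passages-walk ((x ∷ xs) ++ y ∷ ys) x) (walk-++ (x ∷ xs) (y ∷ ys) x) ,
    trans (passages-walk ((y ∷ ys) ++ x ∷ xs) y) (walk-++ (y ∷ ys) (x ∷ xs) y)

module _ {G : Graph} (A B : List (List (Dart G))) where

  passage-or-rest : {c : List (Dart G)} {e : Passage G} → e ∈ allPassages (A ++ c ∷ B) →
    (e ∈ passages c) ⊎ (∀ c′ → e ∈ allPassages (A ++ c′ ∷ B))
  passage-or-rest {c} {e} m with ∈-++⁻ (allPassages A) (subst (e ∈_) (concatMap-++ passages A (c ∷ B)) m)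
  ... | inj₁ m₁ = inj₂ λ c′ → subst (e ∈_) (sym (concatMap-++ passages A (c′ ∷ B))) (∈-++⁺ˡ m₁)
  ... | inj₂ m₂ with ∈-++⁻ (passages c) m₂
  ...   | inj₁ m₃ = inj₁ m₃
  ...   | inj₂ m₄ = inj₂ λ c′ →
    subst (e ∈_) (sym (concatMap-++ passages A (c′ ∷ B))) (∈-++⁺ʳ (allPassages A) (∈-++⁺ʳ (passages c′) m₄))

  edgesOf-replace : {c c′ : List (Dart G)} → c ↭ c′ → edgesOf (A ++ c ∷ B) ↭ edgesOf (A ++ c′ ∷ B)
  edgesOf-replace {c} {c′} p =
    ↭-trans (↭-reflexive (concatMap-++ (map dedge) A (c ∷ B)))
    (↭-trans (++⁺ˡ (edgesOf A) (++⁺ʳ (edgesOf B) (↭-map⁺ dedge p)))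
    (↭-reflexive (sym (concatMap-++ (map dedge) A (c′ ∷ B)))))

-- The situation of the theorem: C contains the circuit  old = ys ++ xs, a rotation of
-- T₁T₂T₃T₄ = v⁺T₁w⁺T₂v⁻T₃w⁻T₄, and  C ∗ (vw)  replaces it by  new = T₃T₂T₁T₄.
module Setting (G : Graph) (FR : FourRegular G) (C : SignedSys G) (SE : IsSignedEuler G C) (v w : Fin (nV G))
  (ds₁ ds₂ ds₃ ds₄ : List (Dart G)) (e₁ e₂ e₃ e₄ : Dart G) (A B : List (List (Dart G))) (xs ys : List (Dart G))
  (rotation : xs ++ ys ≡ (ds₁ ∷ʳ e₁) ++ (ds₂ ∷ʳ e₂) ++ (ds₃ ∷ʳ e₃) ++ (ds₄ ∷ʳ e₄))
  (circuits≡ : circuits C ≡ A ++ (ys ++ xs) ∷ B)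
  (e₄-v⁺ : headHE e₄ ≡ plus C v) (e₁-w⁺ : headHE e₁ ≡ plus C w)
  (e₂-v⁻ : (vtx G (headHE e₂) ≡ v) × (headHE e₂ ≢ plus C v))
  (e₃-w⁻ : (vtx G (headHE e₃) ≡ w) × (headHE e₃ ≢ plus C w)) where

  T₁ T₂ T₃ T₄ old new : List (Dart G)
  T₁ = ds₁ ∷ʳ e₁
  T₂ = ds₂ ∷ʳ e₂
  T₃ = ds₃ ∷ʳ e₃
  T₄ = ds₄ ∷ʳ e₄
  old = ys ++ xs
  new = T₃ ++ T₂ ++ T₁ ++ T₄

  C∗ : SignedSys G
  C∗ = starVW C A B T₁ T₂ T₃ T₄

  Q₁ Q₂ Q₃ Q₄ inner : List (Passage G)
  Q₁ = inside ds₁ e₁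
  Q₂ = inside ds₂ e₂
  Q₃ = inside ds₃ e₃
  Q₄ = inside ds₄ e₄
  inner = Q₁ ++ Q₂ ++ Q₃ ++ Q₄

  -- The passages between trails, in  old  (T₁→T₂ is w⁺, T₂→T₃ is v⁻, T₃→T₄ is w⁻, T₄→T₁ is v⁺)
  -- and in  new  (T₃→T₂ is w⁻, T₂→T₁ is v⁻, T₁→T₄ is w⁺, T₄→T₃ is v⁺).
  old-w⁺ old-v⁻ old-w⁻ old-v⁺ new-w⁻ new-v⁻ new-w⁺ new-v⁺ : Passage G
  old-w⁺ = into e₁ ds₂ e₂
  old-v⁻ = into e₂ ds₃ e₃
  old-w⁻ = into e₃ ds₄ e₄
  old-v⁺ = into e₄ ds₁ e₁
  new-w⁻ = into e₃ ds₂ e₂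
  new-v⁻ = into e₂ ds₁ e₁
  new-w⁺ = into e₁ ds₄ e₄
  new-v⁺ = into e₄ ds₃ e₃

  old-↭ : passages old ↭ old-w⁺ ∷ old-v⁻ ∷ old-w⁻ ∷ old-v⁺ ∷ inner
  old-↭ with passages-rotate xs ys
  ... | r₁ , r₂ , xs++ys , ys++xs =
    ↭-trans (↭-reflexive ys++xs) (↭-trans (++-comm r₂ r₁)
    (↭-trans (↭-reflexive (trans (sym xs++ys) (trans (cong passages rotation) (passages-4 ds₁ ds₂ ds₃ ds₄ e₁ e₂ e₃ e₄))))
    (blocks-↭ Q₁ Q₂ Q₃ Q₄ _ _ _ _)))

  new-blocks : passages new ≡ blocks Q₃ Q₂ Q₁ Q₄ new-w⁻ new-v⁻ new-w⁺ new-v⁺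
  new-blocks = passages-4 ds₃ ds₂ ds₁ ds₄ e₃ e₂ e₁ e₄

  new-↭ : passages new ↭ new-w⁻ ∷ new-v⁻ ∷ new-w⁺ ∷ new-v⁺ ∷ inner
  new-↭ = ↭-trans (↭-reflexive new-blocks) (↭-trans (blocks-↭ Q₃ Q₂ Q₁ Q₄ _ _ _ _)
            (prep _ (prep _ (prep _ (prep _ (swap-blocks-↭ Q₃ Q₂ Q₁ Q₄))))))

  on-old : {e : Passage G} → Among4 old-w⁺ old-v⁻ old-w⁻ old-v⁺ inner e → e ∈ passages old
  on-old (is-p refl) = ∈-resp-↭ (↭-sym old-↭) (here refl)
  on-old (is-q refl) = ∈-resp-↭ (↭-sym old-↭) (there (here refl))
  on-old (is-r refl) = ∈-resp-↭ (↭-sym old-↭) (there (there (here refl)))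
  on-old (is-s refl) = ∈-resp-↭ (↭-sym old-↭) (there (there (there (here refl))))
  on-old (in-Q m)    = ∈-resp-↭ (↭-sym old-↭) (there (there (there (there m))))

  on-new : {e : Passage G} → Among4 new-w⁻ new-v⁻ new-w⁺ new-v⁺ inner e → e ∈ passages new
  on-new (is-p refl) = ∈-resp-↭ (↭-sym new-↭) (here refl)
  on-new (is-q refl) = ∈-resp-↭ (↭-sym new-↭) (there (here refl))
  on-new (is-r refl) = ∈-resp-↭ (↭-sym new-↭) (there (there (here refl)))
  on-new (is-s refl) = ∈-resp-↭ (↭-sym new-↭) (there (there (there (here refl))))
  on-new (in-Q m)    = ∈-resp-↭ (↭-sym new-↭) (there (there (there (there m))))

  plus-at : ∀ z → vtx G (plus C z) ≡ z
  plus-at z = proj₁ (proj₂ SE z)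

  PS : PassageSystem (allPassages (circuits C))
  PS = partition-passageSystem (circuits C) (proj₁ (proj₁ SE))

  covers : ∀ h → h ∈ endpoints (allPassages (circuits C))
  covers = partition-covers (circuits C) (proj₂ (proj₁ (proj₁ SE)))

  open PassageSystem PS using (unique-ends; local)
  open Signed FR C PS plus-at public

  plus-unique-C : {x : Fin (nV G)} {p q : Passage G} → IsPlus C x p → IsPlus C x q → p ≡ q
  plus-unique-C = plus-unique {S = C} unique-ends

  old∈ : old ∈ circuits C
  old∈ = subst (old ∈_) (sym circuits≡) (∈-++⁺ʳ A (here refl))

  of-C : {e : Passage G} → e ∈ passages old → e ∈ allPassages (circuits C)
  of-C = ∈-concatMap-intro passages old∈

  unique-cycle : Unique (old-w⁺ ∷ old-v⁻ ∷ old-w⁻ ∷ old-v⁺ ∷ inner)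
  unique-cycle = unique-↭ old-↭
    (unique-++⁻ˡ (passages old) (unique-++⁻ʳ (allPassages A)
      (subst Unique (concatMap-++ passages A (old ∷ B)) (subst (λ cs → Unique (allPassages cs)) circuits≡ (Endpoints.unique-pairs unique-ends)))))

  old-w⁺-plus : IsPlus C w old-w⁺
  old-w⁺-plus = of-C (on-old (is-p refl)) , e₁-w⁺
  old-v⁻-minus : IsMinus C v old-v⁻
  old-v⁻-minus = of-C (on-old (is-q refl)) , e₂-v⁻
  old-w⁻-minus : IsMinus C w old-w⁻
  old-w⁻-minus = of-C (on-old (is-r refl)) , e₃-w⁻
  old-v⁺-plus : IsPlus C v old-v⁺
  old-v⁺-plus = of-C (on-old (is-s refl)) , e₄-v⁺

  v≢w : v ≢ w
  v≢w refl with plus-unique-C old-w⁺-plus old-v⁺-plus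
  ... | w⁺≡v⁺ with unique-cycle
  ...   | (_ ∷ _ ∷ w⁺≢v⁺ ∷ _) ∷ _ = w⁺≢v⁺ w⁺≡v⁺

  w≢v : w ≢ v
  w≢v e = v≢w (sym e)

  head₁ : vtx G (headHE e₁) ≡ w
  head₁ = trans (cong (vtx G) e₁-w⁺) (plus-at w)
  head₂ : vtx G (headHE e₂) ≡ v
  head₂ = proj₁ e₂-v⁻
  head₃ : vtx G (headHE e₃) ≡ w
  head₃ = proj₁ e₃-w⁻
  head₄ : vtx G (headHE e₄) ≡ v
  head₄ = trans (cong (vtx G) e₄-v⁺) (plus-at v)

  new∈ : new ∈ circuits C∗
  new∈ = ∈-++⁺ʳ A (here refl)

  of-C∗ : {e : Passage G} → e ∈ passages new → e ∈ allPassages (circuits C∗)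
  of-C∗ = ∈-concatMap-intro passages new∈

  from-C∗ : {e : Passage G} → e ∈ allPassages (circuits C∗) →
    Among4 new-w⁻ new-v⁻ new-w⁺ new-v⁺ inner e ⊎ (e ∈ allPassages (circuits C))
  from-C∗ m with passage-or-rest A B m
  ... | inj₁ m-new = inj₁ (among4 (∈-resp-↭ new-↭ m-new))
  ... | inj₂ rest  = inj₂ (subst (λ cs → _ ∈ allPassages cs) (sym circuits≡) (rest old))

  edges∗ : edgesOf (circuits C∗) ↭ allFin (nE G)
  edges∗ = ↭-trans (edgesOf-replace A B new↭old)
             (↭-trans (↭-reflexive (cong edgesOf (sym circuits≡))) (proj₂ (proj₁ (proj₁ SE))))
    where
    new↭old : new ↭ old
    new↭old = ↭-trans (swap-blocks-↭ T₃ T₂ T₁ T₄) (↭-trans (↭-reflexive (sym rotation)) (++-comm xs ys))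

  PS∗ : PassageSystem (allPassages (circuits C∗))
  PS∗ = record { unique-ends = partition-unique-ends (circuits C∗) edges∗ ; local = local∗ }
    where
    local∗ : ∀ {p} → p ∈ allPassages (circuits C∗) → vtx G (proj₁ p) ≡ vtx G (proj₂ p)
    local∗ m with from-C∗ m
    ... | inj₂ m-C                = local m-C
    ... | inj₁ (in-Q q)           = local (of-C (on-old (in-Q q)))
    ... | inj₁ (is-p refl)        = trans head₃ (trans (sym head₁) (local (of-C (on-old (is-p refl)))))
    ... | inj₁ (is-q refl)        = trans head₂ (trans (sym head₄) (local (of-C (on-old (is-s refl)))))
    ... | inj₁ (is-r refl)        = trans head₁ (trans (sym head₃) (local (of-C (on-old (is-r refl)))))
    ... | inj₁ (is-s refl)        = trans head₄ (trans (sym head₂) (local (of-C (on-old (is-q refl)))))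

  new-w⁻-minus : IsMinus C∗ w new-w⁻
  new-w⁻-minus = of-C∗ (on-new (is-p refl)) , e₃-w⁻
  new-v⁻-minus : IsMinus C∗ v new-v⁻
  new-v⁻-minus = of-C∗ (on-new (is-q refl)) , e₂-v⁻
  new-w⁺-plus : IsPlus C∗ w new-w⁺
  new-w⁺-plus = of-C∗ (on-new (is-r refl)) , e₁-w⁺
  new-v⁺-plus : IsPlus C∗ v new-v⁺
  new-v⁺-plus = of-C∗ (on-new (is-s refl)) , e₄-v⁺

  keep : {e : Passage G} → e ∈ allPassages (circuits C) → vtx G (proj₁ e) ≢ v → vtx G (proj₁ e) ≢ w →
    e ∈ allPassages (circuits C∗)
  keep m ≢v ≢w with passage-or-rest A B (subst (λ cs → _ ∈ allPassages cs) circuits≡ m)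
  ... | inj₂ rest = rest new
  ... | inj₁ m-old with among4 (∈-resp-↭ old-↭ m-old)
  ...   | in-Q q    = of-C∗ (on-new (in-Q q))
  ...   | is-p refl = ⊥-elim (≢w head₁)
  ...   | is-q refl = ⊥-elim (≢v head₂)
  ...   | is-r refl = ⊥-elim (≢w head₃)
  ...   | is-s refl = ⊥-elim (≢v head₄)

  keep-plus : {y : Fin (nV G)} {p : Passage G} → y ≢ v → y ≢ w → IsPlus C y p → IsPlus C∗ y p
  keep-plus {y} {p} y≢v y≢w (m , p⁺) = keep m (λ q → y≢v (trans (sym at-y) q)) (λ q → y≢w (trans (sym at-y) q)) , p⁺
    where
    at-y : vtx G (proj₁ p) ≡ y
    at-y = trans (cong (vtx G) p⁺) (plus-at y)

  keep-minus : {y : Fin (nV G)} {p : Passage G} → y ≢ v → y ≢ w → IsMinus C y p → IsMinus C∗ y p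
  keep-minus y≢v y≢w (m , at-y , p≢) = keep m (λ q → y≢v (trans (sym at-y) q)) (λ q → y≢w (trans (sym at-y) q)) , at-y , p≢

  module Transitions (P : List (List (Dart G))) (P-partition : IsCircuitPartition G P) (no-ψ : ∀ x → ¬ IsPsi C P x) where
    open Endpoints unique-ends

    φ-or-χ : ∀ y → IsPhi C P y ⊎ IsChi C P y
    φ-or-χ y with proj₂ (proj₂ SE y)
    ... | h , m with minus-exists covers {y} (m , refl)
    ...   | (h₃ , h₄) , m′ , at₃ , h₃≢ with Passages.transition FR (partition-passageSystem P P-partition)
              (partition-covers P (proj₂ P-partition)) (plus-at y) (trans (sym (local m)) (plus-at y)) at₃ (trans (sym (local m′)) at₃)
              distinct (λ { (l₁₃ , l₂₄) → no-ψ y (_ , _ , _ , _ , (m , refl) , (m′ , at₃ , h₃≢) , l₁₃ , l₂₄) })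
      where
      distinct : Distinct4 (plus C y) h h₃ h₄
      distinct = record
        { n₁₂ = entry≢exit m m
        ; n₁₃ = λ e → h₃≢ (sym e)
        ; n₁₄ = entry≢exit m m′
        ; n₂₃ = λ e → entry≢exit m′ m (sym e)
        ; n₂₄ = λ e → h₃≢ (sym (cong proj₁ (exit-injective m m′ e)))
        ; n₃₄ = entry≢exit m′ m′ }
    ...     | inj₁ (l₁₂ , l₃₄) = inj₁ (_ , _ , _ , _ , (m , refl) , (m′ , at₃ , h₃≢) , l₁₂ , l₃₄)
    ...     | inj₂ (l₁₄ , l₂₃) = inj₂ (_ , _ , _ , _ , (m , refl) , (m′ , at₃ , h₃≢) , l₁₄ , l₂₃)

    φ-v : IsPhi C P v → IsChi C∗ P v
    φ-v (_ , _ , _ , _ , p , m , l₁₂ , l₃₄) with plus-unique-C p old-v⁺-plus | minus-unique old-v⁺-plus m old-v⁻-minus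
    ... | refl | refl = _ , _ , _ , _ , new-v⁺-plus , new-v⁻-minus , l₁₂ , linked-sym l₃₄

    χ-v : IsChi C P v → IsPhi C∗ P v
    χ-v (_ , _ , _ , _ , p , m , l₁₄ , l₂₃) with plus-unique-C p old-v⁺-plus | minus-unique old-v⁺-plus m old-v⁻-minus
    ... | refl | refl = _ , _ , _ , _ , new-v⁺-plus , new-v⁻-minus , l₁₄ , linked-sym l₂₃

    φ-w : IsPhi C P w → IsChi C∗ P w
    φ-w (_ , _ , _ , _ , p , m , l₁₂ , l₃₄) with plus-unique-C p old-w⁺-plus | minus-unique old-w⁺-plus m old-w⁻-minus
    ... | refl | refl = _ , _ , _ , _ , new-w⁺-plus , new-w⁻-minus , l₁₂ , linked-sym l₃₄

    χ-w : IsChi C P w → IsPhi C∗ P w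
    χ-w (_ , _ , _ , _ , p , m , l₁₄ , l₂₃) with plus-unique-C p old-w⁺-plus | minus-unique old-w⁺-plus m old-w⁻-minus
    ... | refl | refl = _ , _ , _ , _ , new-w⁺-plus , new-w⁻-minus , l₁₄ , linked-sym l₂₃

    change : TransitionChange v w (IsPhi C P) (IsChi C P) (IsPhi C∗ P) (IsChi C∗ P)
    change = record
      { φ-or-χ = φ-or-χ
      ; φ-v = φ-v ; χ-v = χ-v ; φ-w = φ-w ; χ-w = χ-w
      ; φ-keep = λ { c≢v c≢w (_ , _ , _ , _ , p , m , l , l′) → _ , _ , _ , _ , keep-plus c≢v c≢w p , keep-minus c≢v c≢w m , l , l′ }
      ; χ-keep = λ { c≢v c≢w (_ , _ , _ , _ , p , m , l , l′) → _ , _ , _ , _ , keep-plus c≢v c≢w p , keep-minus c≢v c≢w m , l , l′ } }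

  inside-trails : {e : Passage G} → e ∈ passages old → vtx G (proj₁ e) ≢ v → vtx G (proj₁ e) ≢ w → e ∈ inner
  inside-trails m ≢v ≢w with among4 (∈-resp-↭ old-↭ m)
  ... | in-Q q    = q
  ... | is-p refl = ⊥-elim (≢w head₁)
  ... | is-q refl = ⊥-elim (≢v head₂)
  ... | is-r refl = ⊥-elim (≢w head₃)
  ... | is-s refl = ⊥-elim (≢v head₄)

  inner-of-old : {e : Passage G} → e ∈ inner → e ∈ passages old
  inner-of-old q = on-old (in-Q q)

  inner-of-new : {e : Passage G} → e ∈ inner → e ∈ passages new
  inner-of-new q = on-new (in-Q q)

  plus-passage : Fin (nV G) → Passage G
  plus-passage z = plus C z , proj₁ (proj₂ (proj₂ SE z))

  plus-passage-plus : ∀ z → IsPlus C z (plus-passage z)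
  plus-passage-plus z = proj₂ (proj₂ (proj₂ SE z)) , refl

  minus-passage : Fin (nV G) → Passage G
  minus-passage z = proj₁ (minus-exists covers (plus-passage-plus z))

  minus-passage-minus : ∀ z → IsMinus C z (minus-passage z)
  minus-passage-minus z = proj₂ (minus-exists covers (plus-passage-plus z))

  OnOld : Fin (nV G) → Set
  OnOld z = plus-passage z ∈ passages old

  onOld? : (z : Fin (nV G)) → Dec (OnOld z)
  onOld? z = any? (λ q → plus-passage z ≟ᵖ q) (passages old)

  -- Circuits of an Euler system are vertex-disjoint, so z⁻ lies on the circuit of z⁺.
  minus-on-old : {z : Fin (nV G)} → OnOld z → minus-passage z ∈ passages old
  minus-on-old {z} on with ∈-concatMap-elim passages (proj₁ (minus-passage-minus z))
  ... | c , c∈ , m with disjoint-blocks-same (verticesOf {G}) (circuits C) (proj₂ (proj₁ SE)) old∈ c∈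
                          (passage-vertex old on) (subst (_∈ verticesOf {G} c) same-vertex (passage-vertex c m))
    where
    same-vertex : vtx G (proj₂ (minus-passage z)) ≡ vtx G (proj₂ (plus-passage z))
    same-vertex = trans (sym (local (proj₁ (minus-passage-minus z))))
                  (trans (proj₁ (proj₂ (minus-passage-minus z))) (trans (sym (plus-at z)) (local (proj₁ (plus-passage-plus z)))))
  ... | refl = m

  off-old : {z : Fin (nV G)} → ¬ OnOld z → ∃ λ c₀ → (c₀ ∈ circuits C) × (c₀ ∈ circuits C∗) × (plus-passage z ∈ passages c₀)
  off-old {z} off with ∈-concatMap-elim passages (proj₁ (plus-passage-plus z))
  ... | c₀ , c₀∈ , m = c₀ , c₀∈ , in-C∗ (subst (c₀ ∈_) circuits≡ c₀∈) , m
    where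
    in-C∗ : c₀ ∈ A ++ old ∷ B → c₀ ∈ A ++ new ∷ B
    in-C∗ i with ∈-++⁻ A i
    ... | inj₁ i₁          = ∈-++⁺ˡ i₁
    ... | inj₂ (here refl) = ⊥-elim (off m)
    ... | inj₂ (there i₂)  = ∈-++⁺ʳ A (there i₂)

  data Further : Letter → Set where
    x⁺ : Further X⁺
    x⁻ : Further X⁻
    y⁺ : Further Y⁺
    y⁻ : Further Y⁻

  private
    unique-inner : Unique inner
    unique-inner with unique-cycle
    ... | _ ∷ _ ∷ _ ∷ _ ∷ u = u

    inner-≢ : {e : Passage G} → e ∈ inner → (e ≢ old-w⁺) × (e ≢ old-v⁻) × (e ≢ old-w⁻) × (e ≢ old-v⁺)
    inner-≢ q with unique-cycle
    ... | w⁺∉ ∷ v⁻∉ ∷ w⁻∉ ∷ v⁺∉ ∷ _ =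
      (λ { refl → All-lookup w⁺∉ (there (there (there q))) refl }) ,
      (λ { refl → All-lookup v⁻∉ (there (there q)) refl }) ,
      (λ { refl → All-lookup w⁻∉ (there q) refl }) ,
      (λ { refl → All-lookup v⁺∉ q refl })

  module Words (x y : Fin (nV G)) where
    open Labelling (plus C) v w x y public
    module Before = LabelledInterlacement (plus C) v w x y C unique-ends
    module After  = LabelledInterlacement (plus C) v w x y C∗ (PassageSystem.unique-ends PS∗)
    open Before using (word) public

    tracks-v∘ : Tracks C v V⁺ V⁻
    tracks-v∘ = tracks-v C refl plus-at
    tracks-w∘ : Tracks C w W⁺ W⁻
    tracks-w∘ = tracks-w C refl plus-at w≢v

    m₁ m₂ m₃ m₄ : List Letter
    m₁ = mapMaybe label Q₁
    m₂ = mapMaybe label Q₂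
    m₃ = mapMaybe label Q₃
    m₄ = mapMaybe label Q₄

    word-inner : mapMaybe label inner ≡ m₁ ++ m₂ ++ m₃ ++ m₄
    word-inner = trans (mapMaybe-++ label Q₁ (Q₂ ++ Q₃ ++ Q₄))
                 (cong (m₁ ++_) (trans (mapMaybe-++ label Q₂ (Q₃ ++ Q₄)) (cong (m₂ ++_) (mapMaybe-++ label Q₃ Q₄))))

    -- The passages between trails carry the letters of v⁺, v⁻, w⁺, w⁻ (before and after,
    -- since a passage is labelled by its entering half-edge).
    label-w⁺ : label old-w⁺ ≡ just W⁺
    label-w⁺ = Names.names (proj₁ tracks-w∘) old-w⁺-plus
    label-v⁻ : label old-v⁻ ≡ just V⁻
    label-v⁻ = Names.names (proj₂ tracks-v∘) old-v⁻-minus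
    label-w⁻ : label old-w⁻ ≡ just W⁻
    label-w⁻ = Names.names (proj₂ tracks-w∘) old-w⁻-minus
    label-v⁺ : label old-v⁺ ≡ just V⁺
    label-v⁺ = Names.names (proj₁ tracks-v∘) old-v⁺-plus

    word-new : word new ≡ after m₁ m₂ m₃ m₄
    word-new = trans (cong (mapMaybe label) new-blocks) (mapMaybe-inOrder label Q₃ Q₂ Q₁ Q₄ [] label-w⁻ label-v⁻ label-w⁺ label-v⁺)

    word-old : (a⁺ a⁻ b⁺ b⁻ : Letter) → interlace (word old) a⁺ a⁻ b⁺ b⁻ ≡ interlace (before m₁ m₂ m₃ m₄) a⁺ a⁻ b⁺ b⁻
    word-old a⁺ a⁻ b⁺ b⁻ with passages-rotate xs ys
    ... | r₁ , r₂ , xs++ys , ys++xs = begin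
      interlace (mapMaybe label (passages (ys ++ xs))) a⁺ a⁻ b⁺ b⁻
        ≡⟨ cong (λ W → interlace W a⁺ a⁻ b⁺ b⁻) (trans (cong (mapMaybe label) ys++xs) (mapMaybe-++ label r₂ r₁)) ⟩
      interlace (mapMaybe label r₂ ++ mapMaybe label r₁) a⁺ a⁻ b⁺ b⁻
        ≡⟨ interlace-rotate (mapMaybe label r₂) (mapMaybe label r₁) a⁺ a⁻ b⁺ b⁻ ⟩
      interlace (mapMaybe label r₁ ++ mapMaybe label r₂) a⁺ a⁻ b⁺ b⁻
        ≡⟨ cong (λ W → interlace W a⁺ a⁻ b⁺ b⁻) (trans (sym (mapMaybe-++ label r₁ r₂)) (cong (mapMaybe label) (sym xs++ys))) ⟩
      interlace (mapMaybe label (passages (xs ++ ys))) a⁺ a⁻ b⁺ b⁻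
        ≡⟨ cong (λ W → interlace W a⁺ a⁻ b⁺ b⁻) (trans (cong (λ c → mapMaybe label (passages c)) rotation)
             (trans (cong (mapMaybe label) (passages-4 ds₁ ds₂ ds₃ ds₄ e₁ e₂ e₃ e₄))
                    (mapMaybe-inOrder label Q₁ Q₂ Q₃ Q₄ [] label-w⁺ label-v⁻ label-w⁻ label-v⁺))) ⟩
      interlace (before m₁ m₂ m₃ m₄) a⁺ a⁻ b⁺ b⁻ ∎
      where open ≡-Reasoning

    label-injective : {e₁ e₂ : Passage G} {t : Letter} → e₁ ∈ allPassages (circuits C) → e₂ ∈ allPassages (circuits C) →
      label e₁ ≡ just t → label e₂ ≡ just t → e₁ ≡ e₂
    label-injective {e₁} {e₂} {t} i₁ i₂ l₁ l₂ with read (proj₁ e₁) l₁ | read (proj₁ e₂) l₂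
    ... | at₁ , sg₁ , _ | at₂ , sg₂ , _ = by-sign (positive t) sg₁ sg₂
      where
      entry : {e : Passage G} → vtx G (proj₁ e) ≡ named t → isEntry (proj₁ e) ≡ true → proj₁ e ≡ plus C (named t)
      entry {e} at sg = trans (does-true (proj₁ e ≟ʰ _) sg) (cong (plus C) at)
      non-entry : {e : Passage G} → e ∈ allPassages (circuits C) → vtx G (proj₁ e) ≡ named t → isEntry (proj₁ e) ≡ false →
        IsMinus C (named t) e
      non-entry {e} m at sg = m , at , λ q → does-false (proj₁ e ≟ʰ _) sg (trans q (cong (plus C) (sym at)))
      by-sign : (b : Bool) → isEntry (proj₁ e₁) ≡ b → isEntry (proj₁ e₂) ≡ b → e₁ ≡ e₂
      by-sign true  b₁ b₂ = plus-unique-C (i₁ , entry {e₁} at₁ b₁) (i₂ , entry {e₂} at₂ b₂)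
      by-sign false b₁ b₂ = minus-unique (plus-passage-plus (named t)) (non-entry i₁ at₁ b₁) (non-entry i₂ at₂ b₂)

    trail-letter : {e : Passage G} {t : Letter} → e ∈ inner → label e ≡ just t → Further t
    trail-letter {t = V⁺} q l = ⊥-elim (proj₂ (proj₂ (proj₂ (inner-≢ q)))
      (label-injective (of-C (inner-of-old q)) (proj₁ old-v⁺-plus) l label-v⁺))
    trail-letter {t = V⁻} q l = ⊥-elim (proj₁ (proj₂ (inner-≢ q))
      (label-injective (of-C (inner-of-old q)) (proj₁ old-v⁻-minus) l label-v⁻))
    trail-letter {t = W⁺} q l = ⊥-elim (proj₁ (inner-≢ q)
      (label-injective (of-C (inner-of-old q)) (proj₁ old-w⁺-plus) l label-w⁺))
    trail-letter {t = W⁻} q l = ⊥-elim (proj₁ (proj₂ (proj₂ (inner-≢ q)))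
      (label-injective (of-C (inner-of-old q)) (proj₁ old-w⁻-minus) l label-w⁻))
    trail-letter {t = X⁺} _ _ = x⁺
    trail-letter {t = X⁻} _ _ = x⁻
    trail-letter {t = Y⁺} _ _ = y⁺
    trail-letter {t = Y⁻} _ _ = y⁻

    unique-trails : Unique (m₁ ++ m₂ ++ m₃ ++ m₄)
    unique-trails = subst Unique word-inner (unique-mapMaybe label inner unique-inner
      (λ i₁ i₂ → label-injective (of-C (inner-of-old i₁)) (of-C (inner-of-old i₂))))

    trails-∈ : {t : Letter} → t ∈ m₁ ++ m₂ ++ m₃ ++ m₄ → ∃ λ e → (e ∈ inner) × (label e ≡ just t)
    trails-∈ {t} m = mapMaybe-preimage label inner (subst (t ∈_) (sym word-inner) m)

    ∈-trails : {e : Passage G} {t : Letter} → e ∈ inner → label e ≡ just t → t ∈ m₁ ++ m₂ ++ m₃ ++ m₄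
    ∈-trails {t = t} q l = subst (t ∈_) word-inner (mapMaybe-∈ label inner q l)

    on-old-letter : {z : Fin (nV G)} {e : Passage G} {t : Letter} → z ≢ v → z ≢ w → e ∈ passages old →
      vtx G (proj₁ e) ≡ z → label e ≡ just t → t ∈ m₁ ++ m₂ ++ m₃ ++ m₄
    on-old-letter z≢v z≢w m at l = ∈-trails (inside-trails m (λ q → z≢v (trans (sym at) q)) (λ q → z≢w (trans (sym at) q))) l

    absent-old : {t : Letter} (z : Fin (nV G)) → ¬ OnOld z →
      (∀ {e} → e ∈ allPassages (circuits C) → label e ≡ just t → IsPlus C z e) → ¬ (t ∈ word old)
    absent-old z off names m with mapMaybe-preimage label (passages old) m
    ... | e , e∈ , l with plus-unique-C (names (of-C e∈) l) (plus-passage-plus z)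
    ... | refl = off e∈

    private
      not-further : {t u : Letter} → Further t → t ≡ u → ¬ Further u → ⊥
      not-further f refl ¬f = ¬f f

    absent-new : {t : Letter} (z : Fin (nV G)) → Further t → ¬ OnOld z →
      (∀ {e} → e ∈ allPassages (circuits C) → label e ≡ just t → IsPlus C z e) → ¬ (t ∈ word new)
    absent-new z further off names m with mapMaybe-preimage label (passages new) m
    ... | e , e∈ , l with among4 (∈-resp-↭ new-↭ e∈)
    ... | in-Q q    = absent-old z off names (mapMaybe-∈ label (passages old) (inner-of-old q) l)
    ... | is-p refl = not-further further (just-injective (trans (sym l) label-w⁻)) (λ ())
    ... | is-q refl = not-further further (just-injective (trans (sym l) label-v⁻)) (λ ())
    ... | is-r refl = not-further further (just-injective (trans (sym l) label-w⁺)) (λ ())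
    ... | is-s refl = not-further further (just-injective (trans (sym l) label-v⁺)) (λ ())

    absent-elsewhere : {t : Letter} {z : Fin (nV G)} {c₀ : List (Dart G)} {q : Passage G} → c₀ ∈ circuits C → ¬ OnOld z →
      plus-passage z ∈ passages c₀ → q ∈ passages old →
      (∀ {e} → e ∈ allPassages (circuits C) → label e ≡ just t → e ≡ q) → ¬ (t ∈ word c₀)
    absent-elsewhere c₀∈ off z∈ q∈ names m with mapMaybe-preimage label _ m
    ... | e , e∈ , l with names (∈-concatMap-intro passages c₀∈ e∈) l
    ... | refl with Before.same-circuit c₀∈ old∈ e∈ q∈
    ... | refl = off z∈

  module Interlacement (I : Matrix (nV G)) (isI : IsInterlacement C I) (I′ : Matrix (nV G)) (isI′ : IsInterlacement C∗ I′) where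

    module At (x y : Fin (nV G)) where
      open Words x y public

      tracks-v∗ : Tracks C∗ v V⁺ V⁻
      tracks-v∗ = tracks-v C∗ refl plus-at
      tracks-w∗ : Tracks C∗ w W⁺ W⁻
      tracks-w∗ = tracks-w C∗ refl plus-at w≢v

      I-old : (a b : Fin (nV G)) {a⁺ a⁻ b⁺ b⁻ : Letter} → a ≢ b → Tracks C a a⁺ a⁻ → Tracks C b b⁺ b⁻ →
        {e : Passage G} → IsPlus C a e → e ∈ passages old → I a b ≡ interlace (before m₁ m₂ m₃ m₄) a⁺ a⁻ b⁺ b⁻
      I-old a b a≢b ta tb e⁺ e∈ = trans (Before.interlacement-word isI a b a≢b ta tb old∈ e⁺ e∈) (word-old _ _ _ _)

      I′-new : (a b : Fin (nV G)) {a⁺ a⁻ b⁺ b⁻ : Letter} → a ≢ b → Tracks C∗ a a⁺ a⁻ → Tracks C∗ b b⁺ b⁻ →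
        {e : Passage G} → IsPlus C∗ a e → e ∈ passages new → I′ a b ≡ interlace (after m₁ m₂ m₃ m₄) a⁺ a⁻ b⁺ b⁻
      I′-new a b a≢b ta tb e⁺ e∈ =
        trans (After.interlacement-word isI′ a b a≢b ta tb new∈ e⁺ e∈) (cong (λ W → interlace W _ _ _ _) word-new)

    -- Interlacement of v and w: with x = y = v only passages of v and w are labelled, so the
    -- trails carry no letters and the values are those of the words  W⁺V⁻W⁻V⁺  and  W⁻V⁻W⁺V⁺.
    module VW where
      open At v v

      no-letters : ∀ {t} → ¬ (t ∈ m₁ ++ m₂ ++ m₃ ++ m₄)
      no-letters m with trails-∈ m
      ... | e , q , l with trail-letter q l | read (proj₁ e) l
      ... | x⁺ | at , _ , ≢v , _     = ≢v at
      ... | x⁻ | at , _ , ≢v , _     = ≢v at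
      ... | y⁺ | at , _ , ≢v , _ , _ = ≢v at
      ... | y⁻ | at , _ , ≢v , _ , _ = ≢v at

      empty : (m₁ , m₂ , m₃ , m₄) ≡ ([] , [] , [] , [])
      empty = go m₁ m₂ m₃ m₄ no-letters
        where
        go : (n₁ n₂ n₃ n₄ : List Letter) → (∀ {t} → ¬ (t ∈ n₁ ++ n₂ ++ n₃ ++ n₄)) →
          (n₁ , n₂ , n₃ , n₄) ≡ ([] , [] , [] , [])
        go (t ∷ _) _       _       _       none = ⊥-elim (none (here refl))
        go []      (t ∷ _) _       _       none = ⊥-elim (none (here refl))
        go []      []      (t ∷ _) _       none = ⊥-elim (none (here refl))
        go []      []      []      (t ∷ _) none = ⊥-elim (none (here refl))
        go []      []      []      []      none = refl

      before-empty : (a⁺ a⁻ b⁺ b⁻ : Letter) →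
        interlace (before m₁ m₂ m₃ m₄) a⁺ a⁻ b⁺ b⁻ ≡ interlace (before [] [] [] []) a⁺ a⁻ b⁺ b⁻
      before-empty a⁺ a⁻ b⁺ b⁻ = cong (λ { (n₁ , n₂ , n₃ , n₄) → interlace (before n₁ n₂ n₃ n₄) a⁺ a⁻ b⁺ b⁻ }) empty

      after-empty : (a⁺ a⁻ b⁺ b⁻ : Letter) →
        interlace (after m₁ m₂ m₃ m₄) a⁺ a⁻ b⁺ b⁻ ≡ interlace (after [] [] [] []) a⁺ a⁻ b⁺ b⁻
      after-empty a⁺ a⁻ b⁺ b⁻ = cong (λ { (n₁ , n₂ , n₃ , n₄) → interlace (after n₁ n₂ n₃ n₄) a⁺ a⁻ b⁺ b⁻ }) empty

      I-wv : I w v ≡ + 1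
      I-wv = trans (I-old w v w≢v tracks-w∘ tracks-v∘ old-w⁺-plus (on-old (is-p refl))) (before-empty _ _ _ _)

      I-vw : I v w ≡ -[1+ 0 ]
      I-vw = trans (I-old v w v≢w tracks-v∘ tracks-w∘ old-v⁺-plus (on-old (is-s refl))) (before-empty _ _ _ _)

      I′-wv : I′ w v ≡ -[1+ 0 ]
      I′-wv = trans (I′-new w v w≢v tracks-w∗ tracks-v∗ new-w⁺-plus (on-new (is-r refl))) (after-empty _ _ _ _)

      I′-vw : I′ v w ≡ + 1
      I′-vw = trans (I′-new v w v≢w tracks-v∗ tracks-w∗ new-v⁺-plus (on-new (is-s refl))) (after-empty _ _ _ _)

    module One (x : Fin (nV G)) (x≢v : x ≢ v) (x≢w : x ≢ w) where
      open At x x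

      v≢x : v ≢ x
      v≢x e = x≢v (sym e)
      w≢x : w ≢ x
      w≢x e = x≢w (sym e)

      tracks-x∘ : Tracks C x X⁺ X⁻
      tracks-x∘ = tracks-x C refl plus-at x≢v x≢w
      tracks-x∗ : Tracks C∗ x X⁺ X⁻
      tracks-x∗ = tracks-x C∗ refl plus-at x≢v x≢w

      x⁺-kept : IsPlus C∗ x (plus-passage x)
      x⁺-kept = keep-plus x≢v x≢w (plus-passage-plus x)

      -- If x lies on old, the trails carry exactly the letters X⁺ and X⁻, and the one-vertex rule applies.
      module OnCircuit (on : OnOld x) where
        rule : OneVertexRule (m₁ , m₂ , m₃ , m₄)
        rule = oneVertexRule m₁ m₂ m₃ m₄ unique-trails only both
          where
          only : ∀ {t} → t ∈ m₁ ++ m₂ ++ m₃ ++ m₄ → t ∈ X⁺ ∷ X⁻ ∷ []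
          only m with trails-∈ m
          ... | e , q , l with trail-letter q l | read (proj₁ e) l
          ... | x⁺ | _                  = here refl
          ... | x⁻ | _                  = there (here refl)
          ... | y⁺ | at , _ , _ , _ , ≢x = ⊥-elim (≢x at)
          ... | y⁻ | at , _ , _ , _ , ≢x = ⊥-elim (≢x at)
          both : ∀ {t} → t ∈ X⁺ ∷ X⁻ ∷ [] → t ∈ m₁ ++ m₂ ++ m₃ ++ m₄
          both (here refl)         = on-old-letter x≢v x≢w on (plus-at x) (Names.names (proj₁ tracks-x∘) (plus-passage-plus x))
          both (there (here refl)) = on-old-letter x≢v x≢w (minus-on-old on) (proj₁ (proj₂ (minus-passage-minus x)))
                                       (Names.names (proj₂ tracks-x∘) (minus-passage-minus x))

        x⁺-on-new : plus-passage x ∈ passages new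
        x⁺-on-new = inner-of-new (inside-trails on (λ q → x≢v (trans (sym (plus-at x)) q)) (λ q → x≢w (trans (sym (plus-at x)) q)))

        I-xv : I x v ≡ interlace (before m₁ m₂ m₃ m₄) X⁺ X⁻ V⁺ V⁻
        I-xv = I-old x v x≢v tracks-x∘ tracks-v∘ (plus-passage-plus x) on
        I-xw : I x w ≡ interlace (before m₁ m₂ m₃ m₄) X⁺ X⁻ W⁺ W⁻
        I-xw = I-old x w x≢w tracks-x∘ tracks-w∘ (plus-passage-plus x) on
        I-vx : I v x ≡ interlace (before m₁ m₂ m₃ m₄) V⁺ V⁻ X⁺ X⁻
        I-vx = I-old v x v≢x tracks-v∘ tracks-x∘ old-v⁺-plus (on-old (is-s refl))
        I-wx : I w x ≡ interlace (before m₁ m₂ m₃ m₄) W⁺ W⁻ X⁺ X⁻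
        I-wx = I-old w x w≢x tracks-w∘ tracks-x∘ old-w⁺-plus (on-old (is-p refl))
        I′-xv : I′ x v ≡ interlace (after m₁ m₂ m₃ m₄) X⁺ X⁻ V⁺ V⁻
        I′-xv = I′-new x v x≢v tracks-x∗ tracks-v∗ x⁺-kept x⁺-on-new
        I′-xw : I′ x w ≡ interlace (after m₁ m₂ m₃ m₄) X⁺ X⁻ W⁺ W⁻
        I′-xw = I′-new x w x≢w tracks-x∗ tracks-w∗ x⁺-kept x⁺-on-new
        I′-vx : I′ v x ≡ interlace (after m₁ m₂ m₃ m₄) V⁺ V⁻ X⁺ X⁻
        I′-vx = I′-new v x v≢x tracks-v∗ tracks-x∗ new-v⁺-plus (on-new (is-s refl))
        I′-wx : I′ w x ≡ interlace (after m₁ m₂ m₃ m₄) W⁺ W⁻ X⁺ X⁻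
        I′-wx = I′-new w x w≢x tracks-w∗ tracks-x∗ new-w⁺-plus (on-new (is-r refl))

      module OffCircuit (off : ¬ OnOld x) where
        c₀ : List (Dart G)
        c₀ = proj₁ (off-old off)
        c₀∈ : c₀ ∈ circuits C
        c₀∈ = proj₁ (proj₂ (off-old off))
        c₀∈∗ : c₀ ∈ circuits C∗
        c₀∈∗ = proj₁ (proj₂ (proj₂ (off-old off)))
        x⁺∈ : plus-passage x ∈ passages c₀
        x⁺∈ = proj₂ (proj₂ (proj₂ (off-old off)))

        no-V⁺ : ¬ (V⁺ ∈ word c₀)
        no-V⁺ = absent-elsewhere c₀∈ off x⁺∈ (on-old (is-s refl)) (λ e∈ l → label-injective e∈ (proj₁ old-v⁺-plus) l label-v⁺)
        no-W⁺ : ¬ (W⁺ ∈ word c₀)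
        no-W⁺ = absent-elsewhere c₀∈ off x⁺∈ (on-old (is-p refl)) (λ e∈ l → label-injective e∈ (proj₁ old-w⁺-plus) l label-w⁺)
        names-x⁺ : ∀ {e} → e ∈ allPassages (circuits C) → label e ≡ just X⁺ → IsPlus C x e
        names-x⁺ = Names.named-only (proj₁ tracks-x∘)

        I-xv : I x v ≡ + 0
        I-xv = trans (Before.interlacement-word isI x v x≢v tracks-x∘ tracks-v∘ c₀∈ (plus-passage-plus x) x⁺∈)
                     (interlace-absent _ _ _ _ _ no-V⁺)
        I-xw : I x w ≡ + 0
        I-xw = trans (Before.interlacement-word isI x w x≢w tracks-x∘ tracks-w∘ c₀∈ (plus-passage-plus x) x⁺∈)
                     (interlace-absent _ _ _ _ _ no-W⁺)
        I′-xv : I′ x v ≡ + 0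
        I′-xv = trans (After.interlacement-word isI′ x v x≢v tracks-x∗ tracks-v∗ c₀∈∗ x⁺-kept x⁺∈) (interlace-absent _ _ _ _ _ no-V⁺)
        I′-xw : I′ x w ≡ + 0
        I′-xw = trans (After.interlacement-word isI′ x w x≢w tracks-x∗ tracks-w∗ c₀∈∗ x⁺-kept x⁺∈) (interlace-absent _ _ _ _ _ no-W⁺)
        I-vx : I v x ≡ + 0
        I-vx = trans (Before.interlacement-word isI v x v≢x tracks-v∘ tracks-x∘ old∈ old-v⁺-plus (on-old (is-s refl)))
                     (interlace-absent _ _ _ _ _ (absent-old x off names-x⁺))
        I-wx : I w x ≡ + 0
        I-wx = trans (Before.interlacement-word isI w x w≢x tracks-w∘ tracks-x∘ old∈ old-w⁺-plus (on-old (is-p refl)))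
                     (interlace-absent _ _ _ _ _ (absent-old x off names-x⁺))
        I′-vx : I′ v x ≡ + 0
        I′-vx = trans (After.interlacement-word isI′ v x v≢x tracks-v∗ tracks-x∗ new∈ new-v⁺-plus (on-new (is-s refl)))
                      (interlace-absent _ _ _ _ _ (absent-new x x⁺ off names-x⁺))
        I′-wx : I′ w x ≡ + 0
        I′-wx = trans (After.interlacement-word isI′ w x w≢x tracks-w∗ tracks-x∗ new∈ new-w⁺-plus (on-new (is-r refl)))
                      (interlace-absent _ _ _ _ _ (absent-new x x⁺ off names-x⁺))

      column-v : I′ x v ≡ I x w
      column-v with onOld? x
      ... | yes on  = let open OnCircuit on in trans I′-xv (trans (proj₁ rule) (sym I-xw))
      ... | no off  = let open OffCircuit off in trans I′-xv (sym I-xw)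

      column-w : I′ x w ≡ - I x v
      column-w with onOld? x
      ... | yes on  = let open OnCircuit on in trans I′-xw (trans (proj₁ (proj₂ rule)) (cong -_ (sym I-xv)))
      ... | no off  = let open OffCircuit off in trans I′-xw (cong -_ (sym I-xv))

      row-v : I′ v x ≡ I w x
      row-v with onOld? x
      ... | yes on  = let open OnCircuit on in trans I′-vx (trans (proj₁ (proj₂ (proj₂ rule))) (sym I-wx))
      ... | no off  = let open OffCircuit off in trans I′-vx (sym I-wx)

      row-w : I′ w x ≡ - I v x
      row-w with onOld? x
      ... | yes on  = let open OnCircuit on in trans I′-wx (trans (proj₁ (proj₂ (proj₂ (proj₂ rule)))) (cong -_ (sym I-vx)))
      ... | no off  = let open OffCircuit off in trans I′-wx (cong -_ (sym I-vx))

      balance : I x w * I v x ≡ I x v * I w x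
      balance with onOld? x
      ... | yes on  = let open OnCircuit on in
        trans (cong₂ _*_ I-xw I-vx) (trans (proj₂ (proj₂ (proj₂ (proj₂ rule)))) (sym (cong₂ _*_ I-xv I-wx)))
      ... | no off  = let open OffCircuit off in
        trans (cong (_* I v x) I-xw) (trans (*-zeroˡ (I v x)) (sym (trans (cong (_* I w x) I-xv) (*-zeroˡ (I w x)))))

    module Two (x y : Fin (nV G)) (x≢v : x ≢ v) (x≢w : x ≢ w) (y≢v : y ≢ v) (y≢w : y ≢ w) (y≢x : y ≢ x) where
      open At x y

      x≢y : x ≢ y
      x≢y e = y≢x (sym e)

      tracks-x∘ : Tracks C x X⁺ X⁻
      tracks-x∘ = tracks-x C refl plus-at x≢v x≢w
      tracks-x∗ : Tracks C∗ x X⁺ X⁻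
      tracks-x∗ = tracks-x C∗ refl plus-at x≢v x≢w
      tracks-y∘ : Tracks C y Y⁺ Y⁻
      tracks-y∘ = tracks-y C refl plus-at y≢v y≢w y≢x
      tracks-y∗ : Tracks C∗ y Y⁺ Y⁻
      tracks-y∗ = tracks-y C∗ refl plus-at y≢v y≢w y≢x

      x⁺-kept : IsPlus C∗ x (plus-passage x)
      x⁺-kept = keep-plus x≢v x≢w (plus-passage-plus x)

      -- Both on old: the trails carry exactly X⁺, X⁻, Y⁺, Y⁻ and the two-vertex rule applies.
      both-on : OnOld x → OnOld y → I′ x y ≡ I x y + I x w * I v y - I x v * I w y
      both-on on-x on-y = begin
        I′ x y
          ≡⟨ I′-new x y x≢y tracks-x∗ tracks-y∗ x⁺-kept (One.OnCircuit.x⁺-on-new x x≢v x≢w on-x) ⟩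
        interlace (after m₁ m₂ m₃ m₄) X⁺ X⁻ Y⁺ Y⁻
          ≡⟨ twoVertexRule m₁ m₂ m₃ m₄ unique-trails only all ⟩
        interlace W X⁺ X⁻ Y⁺ Y⁻ + interlace W X⁺ X⁻ W⁺ W⁻ * interlace W V⁺ V⁻ Y⁺ Y⁻
          - interlace W X⁺ X⁻ V⁺ V⁻ * interlace W W⁺ W⁻ Y⁺ Y⁻
          ≡⟨ sym (cong₂ _-_ (cong₂ _+_ (I-old x y x≢y tracks-x∘ tracks-y∘ (plus-passage-plus x) on-x)
                                       (cong₂ _*_ (I-old x w x≢w tracks-x∘ tracks-w∘ (plus-passage-plus x) on-x)
                                                  (I-old v y (λ e → y≢v (sym e)) tracks-v∘ tracks-y∘ old-v⁺-plus (on-old (is-s refl)))))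
                            (cong₂ _*_ (I-old x v x≢v tracks-x∘ tracks-v∘ (plus-passage-plus x) on-x)
                                       (I-old w y (λ e → y≢w (sym e)) tracks-w∘ tracks-y∘ old-w⁺-plus (on-old (is-p refl))))) ⟩
        I x y + I x w * I v y - I x v * I w y ∎
        where
        open ≡-Reasoning
        W : List Letter
        W = before m₁ m₂ m₃ m₄
        only : ∀ {t} → t ∈ m₁ ++ m₂ ++ m₃ ++ m₄ → t ∈ X⁺ ∷ X⁻ ∷ Y⁺ ∷ Y⁻ ∷ []
        only m with trails-∈ m
        ... | e , q , l with trail-letter q l
        ... | x⁺ = here refl
        ... | x⁻ = there (here refl)
        ... | y⁺ = there (there (here refl))
        ... | y⁻ = there (there (there (here refl)))
        all : ∀ {t} → t ∈ X⁺ ∷ X⁻ ∷ Y⁺ ∷ Y⁻ ∷ [] → t ∈ m₁ ++ m₂ ++ m₃ ++ m₄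
        all (here refl) = on-old-letter x≢v x≢w on-x (plus-at x) (Names.names (proj₁ tracks-x∘) (plus-passage-plus x))
        all (there (here refl)) = on-old-letter x≢v x≢w (minus-on-old on-x) (proj₁ (proj₂ (minus-passage-minus x)))
                                    (Names.names (proj₂ tracks-x∘) (minus-passage-minus x))
        all (there (there (here refl))) = on-old-letter y≢v y≢w on-y (plus-at y) (Names.names (proj₁ tracks-y∘) (plus-passage-plus y))
        all (there (there (there (here refl)))) = on-old-letter y≢v y≢w (minus-on-old on-y) (proj₁ (proj₂ (minus-passage-minus y)))
                                                    (Names.names (proj₂ tracks-y∘) (minus-passage-minus y))

      -- x on old, y off: y is interlaced with none of x, v, w.
      only-x-on : OnOld x → ¬ OnOld y → I′ x y ≡ I x y + I x w * I v y - I x v * I w y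
      only-x-on on-x off-y = begin
        I′ x y                                  ≡⟨ trans (After.interlacement-word isI′ x y x≢y tracks-x∗ tracks-y∗ new∈ x⁺-kept
                                                            (One.OnCircuit.x⁺-on-new x x≢v x≢w on-x))
                                                         (interlace-absent _ _ _ _ _ (absent-new y y⁺ off-y names-y⁺)) ⟩
        + 0                                     ≡⟨ cancel (I x w) (I x v) ⟩
        + 0 + I x w * + 0 - I x v * + 0
          ≡⟨ sym (cong₂ (λ a b → a + I x w * b - I x v * + 0) I-xy (One.OffCircuit.I-vx y y≢v y≢w off-y)) ⟩
        I x y + I x w * I v y - I x v * + 0     ≡⟨ sym (cong (λ b → I x y + I x w * I v y - I x v * b) (One.OffCircuit.I-wx y y≢v y≢w off-y)) ⟩
        I x y + I x w * I v y - I x v * I w y   ∎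
        where
        open ≡-Reasoning
        names-y⁺ : ∀ {e} → e ∈ allPassages (circuits C) → label e ≡ just Y⁺ → IsPlus C y e
        names-y⁺ = Names.named-only (proj₁ tracks-y∘)
        I-xy : I x y ≡ + 0
        I-xy = trans (Before.interlacement-word isI x y x≢y tracks-x∘ tracks-y∘ old∈ (plus-passage-plus x) on-x)
                     (interlace-absent _ _ _ _ _ (absent-old y off-y names-y⁺))
        cancel : ∀ a b → + 0 ≡ + 0 + a * + 0 - b * + 0
        cancel = solve-∀

      -- x off old: its circuit is untouched, and x is interlaced with neither v nor w.
      x-off : ¬ OnOld x → I′ x y ≡ I x y + I x w * I v y - I x v * I w y
      x-off off-x = begin
        I′ x y
          ≡⟨ trans (After.interlacement-word isI′ x y x≢y tracks-x∗ tracks-y∗ c₀∈∗ x⁺-kept x⁺∈)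
                   (sym (Before.interlacement-word isI x y x≢y tracks-x∘ tracks-y∘ c₀∈ (plus-passage-plus x) x⁺∈)) ⟩
        I x y                                   ≡⟨ unchanged (I x y) (I v y) (I w y) ⟩
        I x y + + 0 * I v y - + 0 * I w y       ≡⟨ sym (cong₂ (λ a b → I x y + a * I v y - b * I w y) I-xw I-xv) ⟩
        I x y + I x w * I v y - I x v * I w y   ∎
        where
        open ≡-Reasoning
        open One.OffCircuit x x≢v x≢w off-x using (c₀∈; c₀∈∗; x⁺∈; I-xv; I-xw)
        unchanged : ∀ a b c → a ≡ a + + 0 * b - + 0 * c
        unchanged = solve-∀

      other : I′ x y ≡ I x y + I x w * I v y - I x v * I w y
      other with onOld? x | onOld? y
      ... | yes on-x | yes on-y = both-on on-x on-y
      ... | yes on-x | no off-y = only-x-on on-x off-y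
      ... | no off-x | _        = x-off off-x

    change : InterlacementChange v w I I′
    change = record
      { diag     = λ x → proj₁ (isI x x) refl
      ; diag′    = λ x → proj₁ (isI′ x x) refl
      ; I-wv     = VW.I-wv
      ; I-vw     = VW.I-vw
      ; I′-wv    = VW.I′-wv
      ; I′-vw    = VW.I′-vw
      ; column-v = One.column-v
      ; column-w = One.column-w
      ; row-v    = One.row-v
      ; row-w    = One.row-w
      ; balance  = One.balance
      ; other    = λ x y x≢v x≢w y≢v y≢w y≢x → Two.other x y x≢v x≢w y≢v y≢w y≢x }

proposition19 :
    (G : Graph) → FourRegular G →
    (C : SignedSys G) → IsSignedEuler G C →
    (v w : Fin (nV G)) →
    (ds1 ds2 ds3 ds4 : List (Dart G)) → (e1 e2 e3 e4 : Dart G) →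
    (A B : List (List (Dart G))) → (xs ys : List (Dart G)) →
    xs ++ ys ≡ (ds1 ∷ʳ e1) ++ (ds2 ∷ʳ e2) ++ (ds3 ∷ʳ e3) ++ (ds4 ∷ʳ e4) →
    circuits C ≡ A ++ (ys ++ xs) ∷ B →
    headHE e4 ≡ plus C v →
    headHE e1 ≡ plus C w →
    (vtx G (headHE e2) ≡ v) × (headHE e2 ≢ plus C v) →
    (vtx G (headHE e3) ≡ w) × (headHE e3 ≢ plus C w) →
    (P : List (List (Dart G))) → IsCircuitPartition G P →
    (∀ x → ¬ IsPsi C P x) →
    (I  : Matrix (nV G)) → IsInterlacement C I →
    (I' : Matrix (nV G)) →
      IsInterlacement (starVW C A B (ds1 ∷ʳ e1) (ds2 ∷ʳ e2) (ds3 ∷ʳ e3) (ds4 ∷ʳ e4)) I' →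
    (M  : Matrix (nV G)) → IsM0 C P I M →
    (M' : Matrix (nV G)) →
      IsM0 (starVW C A B (ds1 ∷ʳ e1) (ds2 ∷ʳ e2) (ds3 ∷ʳ e3) (ds4 ∷ʳ e4)) P I' M' →
    (∀ y → M' v y ≡ M w y) ×
    (∀ y → M' w y ≡ - M v y) ×
    (∀ x → x ≢ v → x ≢ w → ∀ y →
       M' x y ≡ M x y + I x w * M v y - I x v * M w y)
proposition19 G FR C SE v w ds₁ ds₂ ds₃ ds₄ e₁ e₂ e₃ e₄ A B xs ys rotation circuits≡ e₄-v⁺ e₁-w⁺ e₂-v⁻ e₃-w⁻
              P P-partition no-ψ I isI I′ isI′ M M-spec M′ M′-spec =
  v-row , w-row , other-rows
  where
  open Setting G FR C SE v w ds₁ ds₂ ds₃ ds₄ e₁ e₂ e₃ e₄ A B xs ys rotation circuits≡ e₄-v⁺ e₁-w⁺ e₂-v⁻ e₃-w⁻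
  open RowIdentities (Interlacement.change I isI I′ isI′) (Transitions.change P P-partition no-ψ) M-spec M′-spec
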